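{- Let $G$ be a graph of genus $g$ with an orientation $\mathfrak o$, $T$ a spanning tree of $G$, $t\ge2$, and $\alpha\in H_1(G,\mathbb Z/t\mathbb Z)$. Then for every length $l$, $$N_t(\alpha,l)=\frac{1}{t^g}\sum_{\gamma\in M_t(\mathbf E_{\mathfrak o}^c(T))}\epsilon_t^{ -\langle\gamma,\alpha\rangle}\operatorname{trace}\left(W_{1,\gamma}^l\right),\qquad \widetilde N_t(\alpha,l)=\frac{1}{t^g}\sum_{\gamma\in M_t(\mathbf E_{\mathfrak o}^c(T))}\epsilon_t^{ -\langle\gamma,\alpha\rangle}\operatorname{trace}\left(A_\gamma^l\right).$$
   Context: A graph is connected and finite, loops and multiple edges allowed, vertices $v_1,\dots,v_n$, edges $e_1,\dots,e_m$, genus $g=m-n+1$. Each edge gives two mutually inverse oriented edges; $\mathbf e(0),\mathbf e(1)$ are initial/terminal vertex. An orientation $\mathfrak o$ picks a positively oriented $\mathbf e_k$ for each $e_k$; $\mathbf E_{\mathfrak o}(G)=\{\mathbf e_1,\dots,\mathbf e_m\}$, $\mathbf E(G)$ is the set of all $2m$ oriented edges, $\mathbf E^c_{\mathfrak o}(T)$ the positively oriented edges not in $T$. A closed walk of length $l$ is $\mathbf a_1\cdots\mathbf a_l$ with $\mathbf a_{i+1}(0)=\mathbf a_i(1)$, $\mathbf a_l(1)=\mathbf a_1(0)$; a circuit is a closed walk with no backtrack ($\mathbf a_{i+1}\ne\mathbf a_i^{ -1}$) and no tail ($\mathbf a_l\ne\mathbf a_1^{ -1}$), counted as sequences. $C_1(G,R)$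 is the free $R$-module on $\mathbf E_{\mathfrak o}(G)$ with $1\cdot\mathbf e^{ -1}=-1\cdot\mathbf e$; $\langle\sum a_k\mathbf e_k,\sum b_k\mathbf e_k\rangle=\sum a_kb_k$. $H_1(G,R)$ consists of $\sum a_k\mathbf e_k$ with $\sum_{\mathbf e_k(0)=v}a_k=\sum_{\mathbf e_k(1)=v}a_k$ for every vertex $v$. $M_t(\mathbf F)\subseteq C_1(G,\mathbb Z/t\mathbb Z)$ is the submodule of elements supported on $\mathbf F$. The abelianization of a walk $C=\mathbf a_1\cdots\mathbf a_l$ is $C^{ab}=\sum\mathbf a_i\in C_1(G,\mathbb Z)$, and $C^{ab}_{[t]}$ its reduction mod $t$. $N_t(\alpha,l)$ (resp. $\widetilde N_t(\alpha,l)$) is the number of circuits (resp. closed walks) $C$ of length $l$ with $C^{ab}_{[t]}=\alpha$. $\epsilon_t=\exp(2\pi i/t)$; for $\gamma\in C_1(G,\mathbb Z/t\mathbb Z)$, $\chi_\gamma(\mathbf e)=\epsilon_t^{\langle\gamma,1\cdot\mathbf e\rangle}$. $A_\gamma$: $n\times n$, $(i,j)$ entry $\sum\chi_\gamma(\mathbf e)$ over $\mathbf e\in\mathbf E(G)$ from $v_i$ to $v_j$. $\mathbf e$ feeds into $\mathbf e'$ if $\mathbf e'\ne\mathbf e^{ -1}$ and $\mathbf e(1)=\mathbf e'(0)$; $W_{1,\gamma}$: $2m\times 2m$ indexed by $\mathbf E(G)$, $(\mathbf e,\mathbf e')$ entry $\chi_\gamma(\mathbf e)$ if $\mathbf e$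 feeds into $\mathbf e'$, else $0$. -}

module Defs where

open import Level using (Level; _⊔_)
open import Data.Nat as ℕ using (ℕ; zero; suc; _∸_; _<?_)
open import Data.Nat.Properties using () renaming (_≟_ to _≟ℕ_)
import Data.Nat.Divisibility as ND
open import Data.Integer as ℤ using (ℤ; +_; -_)
import Data.Integer.Divisibility as ZD
open import Data.Fin as F using (Fin; toℕ; fromℕ<)
open import Data.Fin.Properties using (all?) renaming (_≟_ to _≟F_)
open import Data.Bool using (Bool; true; false; not; if_then_else_; _∧_)
open import Data.Bool.Properties using () renaming (_≟_ to _≟B_)
open import Data.Product using (Σ; _×_; _,_; proj₁; proj₂)
open import Data.Product.Properties using (≡-dec)
open import Data.Sum using (_⊎_)
open import Data.List as L using (List; []; _∷_)
open import Data.Vec as V using (Vec)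
open import Relation.Nullary using (¬_; Dec; yes; no; ¬?; _×-dec_; does)
open import Relation.Binary.PropositionalEquality using (_≡_; _≢_)
open import Algebra.Bundles using (CommutativeRing)

-- The orientation
-- o is built in: the positively oriented edge e_k goes from src k to tgt k.
-- Loops (src k = tgt k) and multiple edges are allowed.

record Graph : Set where
  field
    n m : ℕ
    src tgt : Fin m → Fin n

vecs : ∀ {a} {A : Set a} → List A → (l : ℕ) → List (Vec A l)
vecs xs zero = V.[] ∷ []
vecs xs (suc l) = L.concatMap (λ x → L.map (x V.∷_) (vecs xs l)) xs

next : ∀ {l} → Fin (suc l) → Fin (suc l)
next {l} i with suc (toℕ i) <? suc l
... | yes p = fromℕ< p
... | no _ = F.zero

sumℤ : ∀ {a} {A : Set a} → List A → (A → ℤ) → ℤ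
sumℤ xs f = L.foldr (λ x r → f x ℤ.+ r) (+ 0) xs

sumℕ : ∀ {a} {A : Set a} → List A → (A → ℕ) → ℕ
sumℕ xs f = L.foldr (λ x r → f x ℕ.+ r) 0 xs

_≡[mod_]_ : ℤ → ℕ → ℤ → Set
x ≡[mod t ] y = (+ t) ZD.∣ (x ℤ.- y)

_≡[mod_]?_ : ∀ x t y → Dec (x ≡[mod t ] y)
x ≡[mod t ]? y = t ND.∣? ℤ.∣ x ℤ.- y ∣

-- elements of C_1(G, ℤ/tℤ): coefficient functions Fin m → Fin t
allChains : (t m : ℕ) → List (Fin m → Fin t)
allChains t m = L.map V.lookup (vecs (L.allFin t) m)

module GraphDefs (G : Graph) where
  open Graph G public

  -- oriented edges: (k , true) = e_k , (k , false) = e_k⁻¹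
  OE : Set
  OE = Fin m × Bool

  start end : OE → Fin n
  start (k , true) = src k
  start (k , false) = tgt k
  end (k , true) = tgt k
  end (k , false) = src k

  inv : OE → OE
  inv (k , b) = (k , not b)

  allOE : List OE
  allOE = L.concatMap (λ k → (k , true) ∷ (k , false) ∷ []) (L.allFin m)

  _≟OE_ : (e e' : OE) → Dec (e ≡ e')
  _≟OE_ = ≡-dec _≟F_ _≟B_

  -- a subset S of edges (S k ≡ true means e_k ∈ S); reachability using
  -- edges of S (in either direction)
  data Reach (S : Fin m → Bool) : Fin n → Fin n → Set where
    here : ∀ v → Reach S v v
    step : ∀ (e : OE) {v} → S (proj₁ e) ≡ true → Reach S (end e) v → Reach S (start e) v

  ConnectedVia : (Fin m → Bool) → Set
  ConnectedVia S = ∀ u v → Reach S u v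

  allEdges : Fin m → Bool
  allEdges _ = true

  Connected : Set
  Connected = ConnectedVia allEdges

  -- closed walks a_1 ⋯ a_l (l = suc l'), as sequences:
  -- a_{i+1}(0) = a_i(1) and a_l(1) = a_1(0)
  IsClosedWalk : ∀ {l} → Vec OE (suc l) → Set
  IsClosedWalk w = ∀ i → start (V.lookup w (next i)) ≡ end (V.lookup w i)

  -- circuits: closed walks with no backtrack (a_{i+1} ≠ a_i⁻¹) and no
  -- tail (a_1 ≠ a_l⁻¹)
  IsCircuit : ∀ {l} → Vec OE (suc l) → Set
  IsCircuit w = IsClosedWalk w × (∀ i → V.lookup w (next i) ≢ inv (V.lookup w i))

  closedWalk? : ∀ {l} (w : Vec OE (suc l)) → Dec (IsClosedWalk w)
  closedWalk? w = all? (λ i → start (V.lookup w (next i)) ≟F end (V.lookup w i))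

  circuit? : ∀ {l} (w : Vec OE (suc l)) → Dec (IsCircuit w)
  circuit? w = closedWalk? w ×-dec all? (λ i → ¬? (V.lookup w (next i) ≟OE inv (V.lookup w i)))

  IsSpanningTree : (Fin m → Bool) → Set
  IsSpanningTree T = ConnectedVia T ×
    (∀ l (w : Vec OE (suc l)) → (∀ i → T (proj₁ (V.lookup w i)) ≡ true) → ¬ IsCircuit w)

  genus : ℕ
  genus = m ℕ.+ 1 ∸ n

  abCoeff : ∀ {l} → Vec OE l → Fin m → ℤ
  abCoeff w k = sumℤ (V.toList w) contrib
    where
    contrib : OE → ℤ
    contrib (k' , b) with does (k' ≟F k)
    ... | false = + 0
    ... | true = if b then + 1 else - (+ 1)

  AbModEq : ∀ {l} (t : ℕ) → Vec OE l → (Fin m → Fin t) → Set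
  AbModEq t w α = ∀ k → abCoeff w k ≡[mod t ] (+ toℕ (α k))

  abModEq? : ∀ {l} (t : ℕ) (w : Vec OE l) (α : Fin m → Fin t) → Dec (AbModEq t w α)
  abModEq? t w α = all? (λ k → abCoeff w k ≡[mod t ]? (+ toℕ (α k)))

  IsCycle : (t : ℕ) → (Fin m → Fin t) → Set
  IsCycle t α = ∀ v →
    sumℤ (L.allFin m) (λ k → if does (src k ≟F v) then + toℕ (α k) else + 0)
      ≡[mod t ]
    sumℤ (L.allFin m) (λ k → if does (tgt k ≟F v) then + toℕ (α k) else + 0)

  -- N_t(α, l) and Ñ_t(α, l), for length l = suc l'
  N : (t : ℕ) → (Fin m → Fin t) → (l' : ℕ) → ℕ
  N t α l' = L.length (L.filter (λ w → circuit? w ×-dec abModEq? t w α) (vecs allOE (suc l')))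

  Ñ : (t : ℕ) → (Fin m → Fin t) → (l' : ℕ) → ℕ
  Ñ t α l' = L.length (L.filter (λ w → closedWalk? w ×-dec abModEq? t w α) (vecs allOE (suc l')))

  -- ⟨γ, α⟩ (as a natural number representative)
  pairing : ∀ {t} → (Fin m → Fin t) → (Fin m → Fin t) → ℕ
  pairing γ α = sumℕ (L.allFin m) (λ k → toℕ (γ k) ℕ.* toℕ (α k))

  -- M_t(E^c_o(T)): chains supported on edges not in T
  InM : ∀ {t} → (Fin m → Bool) → (Fin m → Fin t) → Set
  InM T γ = ∀ k → T k ≡ true → toℕ (γ k) ≡ 0

  inM? : ∀ {t} (T : Fin m → Bool) (γ : Fin m → Fin t) → Dec (InM T γ)
  inM? T γ = all? (λ k → helper (T k) (toℕ (γ k)))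
    where
    helper : ∀ b x → Dec (b ≡ true → x ≡ 0)
    helper false x = yes (λ ())
    helper true x with x ≟ℕ 0
    ... | yes p = yes (λ _ → p)
    ... | no ¬p = no (λ f → ¬p (f _≡_.refl))

  M : (t : ℕ) → (Fin m → Bool) → List (Fin m → Fin t)
  M t T = L.filter (inM? T) (allChains t m)

IsIntegralDomain : ∀ {c ℓ} → CommutativeRing c ℓ → Set (c ⊔ ℓ)
IsIntegralDomain R = ¬ (1# ≈ 0#) × (∀ x y → x * y ≈ 0# → x ≈ 0# ⊎ y ≈ 0#)
  where open CommutativeRing R

module RingDefs {c ℓ} (R : CommutativeRing c ℓ) where
  open CommutativeRing R

  pow : Carrier → ℕ → Carrier
  pow x zero = 1#
  pow x (suc k) = x * pow x k

  ofℕ : ℕ → Carrier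
  ofℕ zero = 0#
  ofℕ (suc k) = 1# + ofℕ k

  IsPrimitiveRoot : ℕ → Carrier → Set ℓ
  IsPrimitiveRoot t ε = pow ε t ≈ 1# × (∀ k → 1 ℕ.≤ k → k ℕ.< t → ¬ (pow ε k ≈ 1#))

  sumL : ∀ {a} {A : Set a} → List A → (A → Carrier) → Carrier
  sumL xs f = L.foldr (λ x r → f x + r) 0# xs

  Mat : ∀ {a} → Set a → Set (a ⊔ c)
  Mat I = I → I → Carrier

  mul : ∀ {a} {I : Set a} → List I → Mat I → Mat I → Mat I
  mul xs A B i j = sumL xs (λ k → A i k * B k j)

  -- powS xs A l' = A^(l'+1)
  powS : ∀ {a} {I : Set a} → List I → Mat I → ℕ → Mat I
  powS xs A zero = A
  powS xs A (suc k) = mul xs (powS xs A k) A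

  trace : ∀ {a} {I : Set a} → List I → Mat I → Carrier
  trace xs A = sumL xs (λ i → A i i)

  module _ (G : Graph) (t : ℕ) (ε : Carrier) where
    open GraphDefs G

    -- ε^{-x}, using ε^t = 1 (so ε^{-1} = ε^{t-1})
    εinv^ : ℕ → Carrier
    εinv^ x = pow ε ((t ∸ 1) ℕ.* x)

    -- χ_γ(e) = ε^{⟨γ, 1·e⟩}
    χ : (Fin m → Fin t) → OE → Carrier
    χ γ (k , true) = pow ε (toℕ (γ k))
    χ γ (k , false) = εinv^ (toℕ (γ k))

    Aγ : (Fin m → Fin t) → Mat (Fin n)
    Aγ γ i j = sumL allOE (λ e →
      if does (start e ≟F i) ∧ does (end e ≟F j) then χ γ e else 0#)

    W1γ : (Fin m → Fin t) → Mat OE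
    W1γ γ e e' = if does (¬? (e' ≟OE inv e)) ∧ does (end e ≟F start e') then χ γ e else 0#

{-# OPTIONS --safe #-}
-- Expanding trace (W₁,γ^l) and trace (A_γ^l) as sums over cyclic sequences of l oriented
-- edges leaves exactly the circuits, respectively the closed walks C, each weighted by
-- χ_γ(C) = ε^⟨γ, C^ab⟩. Summing ε^-⟨γ,α⟩ χ_γ(C) over γ ∈ M_t(E^c(T)) factors over the edges
-- outside T, and orthogonality of the t-th roots of unity makes it t^g when C^ab ≡ α (mod t)
-- on every edge outside T, and 0 otherwise. Since C^ab - α is a cycle mod t, and a cycle
-- that vanishes off a spanning tree vanishes (otherwise its support would carry an infinite
-- non-backtracking walk inside the tree), the factor is t^g [C^ab_[t] = α]. That exactly g
-- edges lie outside T, i.e. a tree on n vertices has n - 1 edges, follows by contracting leaves.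
module Submission where

open import Defs
open import Data.Nat using (ℕ; suc; _≤_; _^_)
open import Data.Fin using (Fin)
open import Data.Bool using (Bool)
import Data.List
open import Data.Product using (_×_)
open import Algebra.Bundles using (CommutativeRing)

open import Level using (Level)
open import Algebra.Bundles using (CommutativeMonoid)
open import Data.Nat.Base as ℕ using (ℕ; zero; suc; _∸_; _%_; _/_; s≤s; z≤n; s≤s⁻¹; s<s⁻¹; NonZero; >-nonZero)
import Data.Nat.Properties as ℕ
open import Data.Nat.DivMod using (m≡m%n+[m/n]*n; m%n<n)
open import Data.Nat.Divisibility using (divides; m%n≡0⇒n∣m) renaming (_∣_ to _∣ℕ_; _∣?_ to _∣ℕ?_)
import Data.Nat.Tactic.RingSolver as ℕ-Solver
open import Data.Integer.Base as ℤ using (ℤ; +_)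
import Data.Integer.Properties as ℤ
open import Data.Integer.Divisibility.Signed as ℤ∣ using (_∣_; _∣?_)
open import Data.Integer.Tactic.RingSolver using (solve-∀)
open import Data.Fin.Base using (Fin; zero; suc; toℕ; fromℕ<; punchIn; punchOut)
open import Data.Fin.Properties as Fin using (_≟_; all?; any?; pigeonhole; punchInᵢ≢i; toℕ-inject₁; toℕ-fromℕ; toℕ-fromℕ<)
open import Data.Bool.Base using (Bool; true; false; not; if_then_else_; _∧_)
import Data.Bool.Properties as Bool
open import Data.Empty using (⊥)
open import Data.Product.Base using (∃; _×_; _,_; proj₁; proj₂)
open import Data.Sum.Base using (_⊎_; inj₁; inj₂)
open import Data.List.Base as List using (List; []; _∷_; _++_)
open import Data.Vec.Base as Vec using (Vec; []; _∷_; _∷ʳ_; lookup; tabulate; toList)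
open import Data.Vec.Properties using (lookup∘tabulate; toList-∷ʳ)
open import Data.Vec.Relation.Binary.Pointwise.Inductive as Pointwise using (Pointwise; []; _∷_)
import Data.Vec.Relation.Binary.Pointwise.Extensional as Extensional
open import Function.Base using (_∘_; id)
open import Function.Bundles using (_⇔_; mk⇔; Equivalence)
import Function.Properties.Equivalence as ⇔
open import Relation.Binary.Core using (Rel)
open import Relation.Binary.Definitions using (Decidable)
open import Relation.Binary.PropositionalEquality as ≡ using (_≡_; _≢_)
open import Relation.Nullary.Decidable as Dec using (Dec; yes; no; does; ¬?; _×-dec_; _⊎-dec_; _→-dec_; does-⇔; dec-true; dec-false)
open import Relation.Nullary.Negation using (¬_; contradiction)
import Algebra.Properties.CommutativeMonoid.Sum ℕ.+-0-commutativeMonoid as ℕΣ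
import Algebra.Properties.CommutativeMonoid.Sum ℤ.+-0-commutativeMonoid as ℤΣ

private variable
  a b p r : Level
  A B I : Set a
  k l : ℕ

-- Cyclic sequences

rotate : Vec A (suc l) → Vec A (suc l)
rotate (x ∷ w) = w ∷ʳ x

lookup-∷ʳ-< : ∀ (w : Vec A l) x i (i<l : toℕ i ℕ.< l) → lookup (w ∷ʳ x) i ≡ lookup w (fromℕ< i<l)
lookup-∷ʳ-< (_ ∷ _) x zero    _   = ≡.refl
lookup-∷ʳ-< (_ ∷ w) x (suc i) i<l = lookup-∷ʳ-< w x i (s<s⁻¹ i<l)

lookup-∷ʳ-≥ : ∀ (w : Vec A l) x i → l ℕ.≤ toℕ i → lookup (w ∷ʳ x) i ≡ x
lookup-∷ʳ-≥ []      x zero    _   = ≡.refl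
lookup-∷ʳ-≥ (_ ∷ w) x (suc i) l≤i = lookup-∷ʳ-≥ w x i (s≤s⁻¹ l≤i)

lookup-next : ∀ (u : Vec A (suc l)) i → lookup u (next i) ≡ lookup (rotate u) i
lookup-next {l = l} (x ∷ w) i with suc (toℕ i) ℕ.<? suc l
... | yes i<l = ≡.sym (lookup-∷ʳ-< w x i (s<s⁻¹ i<l))
... | no  i≮l = ≡.sym (lookup-∷ʳ-≥ w x i (s≤s⁻¹ (ℕ.≮⇒≥ i≮l)))

module _ (R : Rel A r) where

  Cyclic : Vec A (suc l) → Set r
  Cyclic u = ∀ i → R (lookup u i) (lookup u (next i))

  cyclic⇔pointwise-rotate : (u : Vec A (suc l)) → Cyclic u ⇔ Pointwise R u (rotate u)
  cyclic⇔pointwise-rotate u = mk⇔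
    (λ cyc → Extensional.extensional⇒inductive (Extensional.ext λ i → ≡.subst (R _) (lookup-next u i) (cyc i)))
    (λ pw i → ≡.subst (R _) (≡.sym (lookup-next u i)) (Pointwise.lookup pw i))

  tabulate-linked : ∀ (b : ℕ → A) d y → (∀ k → R (b k) (b (suc k))) → R (b d) y →
    Pointwise R (tabulate {n = suc d} (b ∘ toℕ)) (tabulate {n = d} (b ∘ suc ∘ toℕ) ∷ʳ y)
  tabulate-linked b zero    y linked last = last ∷ []
  tabulate-linked b (suc d) y linked last = linked 0 ∷ tabulate-linked (b ∘ suc) d y (linked ∘ suc) last

module ListFold {c ℓ} (M : CommutativeMonoid c ℓ) where
  open CommutativeMonoid M
  open import Algebra.Properties.CommutativeMonoid.Sum M using (sum; sum-remove; sum-cong-≋; sum-replicate-zero)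
  open import Algebra.Properties.CommutativeSemigroup commutativeSemigroup using (interchange)
  open import Relation.Binary.Reasoning.Setoid setoid

  foldMap : List A → (A → Carrier) → Carrier
  foldMap xs f = List.foldr (λ x r → f x ∙ r) ε xs

  foldMap-cong : ∀ (xs : List A) {f g : A → Carrier} → (∀ x → f x ≈ g x) → foldMap xs f ≈ foldMap xs g
  foldMap-cong []       f≈g = refl
  foldMap-cong (x ∷ xs) f≈g = ∙-cong (f≈g x) (foldMap-cong xs f≈g)

  foldMap-ε : ∀ (xs : List A) → foldMap xs (λ _ → ε) ≈ ε
  foldMap-ε []       = refl
  foldMap-ε (x ∷ xs) = trans (identityˡ _) (foldMap-ε xs)

  foldMap-++ : ∀ (xs ys : List A) (f : A → Carrier) → foldMap (xs ++ ys) f ≈ foldMap xs f ∙ foldMap ys f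
  foldMap-++ []       ys f = sym (identityˡ _)
  foldMap-++ (x ∷ xs) ys f = trans (∙-congˡ (foldMap-++ xs ys f)) (sym (assoc _ _ _))

  foldMap-map : ∀ (g : A → B) xs (f : B → Carrier) → foldMap (List.map g xs) f ≡ foldMap xs (f ∘ g)
  foldMap-map g []       f = ≡.refl
  foldMap-map g (x ∷ xs) f = ≡.cong (f (g x) ∙_) (foldMap-map g xs f)

  foldMap-concatMap : ∀ (g : A → List B) xs (f : B → Carrier) →
    foldMap (List.concatMap g xs) f ≈ foldMap xs (λ x → foldMap (g x) f)
  foldMap-concatMap g []       f = refl
  foldMap-concatMap g (x ∷ xs) f = trans (foldMap-++ (g x) _ f) (∙-congˡ (foldMap-concatMap g xs f))

  foldMap-∙ : ∀ (xs : List A) (f g : A → Carrier) → foldMap xs (λ x → f x ∙ g x) ≈ foldMap xs f ∙ foldMap xs g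
  foldMap-∙ []       f g = sym (identityˡ _)
  foldMap-∙ (x ∷ xs) f g = trans (∙-congˡ (foldMap-∙ xs f g)) (interchange _ _ _ _)

  foldMap-comm : ∀ (xs : List A) (ys : List B) (f : A → B → Carrier) →
    foldMap xs (λ x → foldMap ys (f x)) ≈ foldMap ys (λ y → foldMap xs (λ x → f x y))
  foldMap-comm []       ys f = sym (foldMap-ε ys)
  foldMap-comm (x ∷ xs) ys f = trans (∙-congˡ (foldMap-comm xs ys f)) (sym (foldMap-∙ ys (f x) _))

  foldMap-tabulate : ∀ n (g : Fin n → A) (f : A → Carrier) → foldMap (List.tabulate g) f ≡ sum (f ∘ g)
  foldMap-tabulate zero    g f = ≡.refl
  foldMap-tabulate (suc n) g f = ≡.cong (f (g zero) ∙_) (foldMap-tabulate n (g ∘ suc) f)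

  foldMap-rotate : ∀ {l} (u : Vec A (suc l)) f → foldMap (Vec.toList (rotate u)) f ≈ foldMap (Vec.toList u) f
  foldMap-rotate (x Vec.∷ w) f = begin
    foldMap (Vec.toList (w ∷ʳ x)) f                    ≡⟨ ≡.cong (λ xs → foldMap xs f) (toList-∷ʳ x w) ⟩
    foldMap (Vec.toList w List.++ List.[ x ]) f        ≈⟨ foldMap-++ (Vec.toList w) _ f ⟩
    foldMap (Vec.toList w) f ∙ (f x ∙ ε)               ≈⟨ comm _ _ ⟩
    (f x ∙ ε) ∙ foldMap (Vec.toList w) f               ≈⟨ ∙-congʳ (identityʳ (f x)) ⟩
    f x ∙ foldMap (Vec.toList w) f                     ∎

  foldMap-pointwise : ∀ {l} {R : A → B → Set} {u : Vec A l} {u′ : Vec B l} (f : A → Carrier) (g : B → Carrier) →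
    (∀ {x y} → R x y → f x ≈ g y) → Pointwise R u u′ → foldMap (Vec.toList u) f ≈ foldMap (Vec.toList u′) g
  foldMap-pointwise f g f≈g []         = refl
  foldMap-pointwise f g f≈g (r ∷ rs) = ∙-cong (f≈g r) (foldMap-pointwise f g f≈g rs)

  foldMap-allFin-single : ∀ {n} (i : Fin n) {f} → (∀ j → j ≢ i → f j ≈ ε) → foldMap (List.allFin n) f ≈ f i
  foldMap-allFin-single {suc n} i {f} others≈ε = begin
    foldMap (List.allFin (suc n)) f ≡⟨ foldMap-tabulate (suc n) (λ j → j) f ⟩
    sum f                           ≈⟨ sum-remove f ⟩
    f i ∙ sum {n} (f ∘ punchIn i)   ≈⟨ ∙-congˡ (sum-cong-≋ λ j → others≈ε (punchIn i j) (punchInᵢ≢i i j)) ⟩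
    f i ∙ sum {n} (λ _ → ε)         ≈⟨ ∙-congˡ (sum-replicate-zero n) ⟩
    f i ∙ ε                         ≈⟨ identityʳ (f i) ⟩
    f i                             ∎

  foldMap-vecs-∷ : ∀ (xs : List A) l (f : Vec A (suc l) → Carrier) →
    foldMap (vecs xs (suc l)) f ≈ foldMap xs (λ x → foldMap (vecs xs l) (f ∘ (x Vec.∷_)))
  foldMap-vecs-∷ xs l f =
    trans (foldMap-concatMap _ xs f) (foldMap-cong xs λ x → reflexive (foldMap-map (x Vec.∷_) (vecs xs l) f))

  foldMap-vecs-∷ʳ : ∀ (xs : List A) l (f : Vec A (suc l) → Carrier) →
    foldMap (vecs xs (suc l)) f ≈ foldMap (vecs xs l) (λ w → foldMap xs (λ x → f (w ∷ʳ x)))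
  foldMap-vecs-∷ʳ xs zero    f =
    trans (foldMap-vecs-∷ xs zero f) (trans (foldMap-cong xs λ _ → identityʳ _) (sym (identityʳ _)))
  foldMap-vecs-∷ʳ xs (suc l) f = begin
    foldMap (vecs xs (suc (suc l))) f
      ≈⟨ foldMap-vecs-∷ xs (suc l) f ⟩
    foldMap xs (λ y → foldMap (vecs xs (suc l)) (f ∘ (y Vec.∷_)))
      ≈⟨ foldMap-cong xs (λ y → foldMap-vecs-∷ʳ xs l (f ∘ (y Vec.∷_))) ⟩
    foldMap xs (λ y → foldMap (vecs xs l) (λ w → foldMap xs (λ x → f (y Vec.∷ (w ∷ʳ x)))))
      ≈⟨ foldMap-vecs-∷ xs l _ ⟨
    foldMap (vecs xs (suc l)) (λ w → foldMap xs (λ x → f (w ∷ʳ x))) ∎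

∣_∣ : ∀ {m} → (Fin m → Bool) → ℕ
∣ S ∣ = ℕΣ.sum (λ k → if S k then 1 else 0)

∣S∣≡0 : ∀ {m} (S : Fin m → Bool) → (∀ k → S k ≡ false) → ∣ S ∣ ≡ 0
∣S∣≡0 {m} S none =
  ≡.trans (ℕΣ.sum-cong-≗ (λ k → ≡.cong (λ b → if b then 1 else 0) (none k))) (ℕΣ.sum-replicate-zero m)

∣S∣+∣∁S∣≡m : ∀ {m} (S : Fin m → Bool) → ∣ S ∣ ℕ.+ ∣ not ∘ S ∣ ≡ m
∣S∣+∣∁S∣≡m {zero}  S = ≡.refl
∣S∣+∣∁S∣≡m {suc m} S with S zero
... | true  = ≡.cong suc (∣S∣+∣∁S∣≡m (S ∘ suc))
... | false = ≡.trans (ℕ.+-suc ∣ S ∘ suc ∣ _) (≡.cong suc (∣S∣+∣∁S∣≡m (S ∘ suc)))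

sumℕ-*ˡ : ∀ c (xs : List A) f → c ℕ.* sumℕ xs f ≡ sumℕ xs (λ x → c ℕ.* f x)
sumℕ-*ˡ c []       f = ℕ.*-zeroʳ c
sumℕ-*ˡ c (x ∷ xs) f = ≡.trans (ℕ.*-distribˡ-+ c (f x) _) (≡.cong (c ℕ.* f x ℕ.+_) (sumℕ-*ˡ c xs f))

module RingSums {c ℓ} (R : CommutativeRing c ℓ) where
  open CommutativeRing R hiding (zero)
  open RingDefs R
  open import Algebra.Properties.CommutativeMonoid.Sum *-commutativeMonoid public
    using () renaming (sum to ∏; sum-cong-≋ to ∏-cong; ∑-distrib-+ to ∏-distrib-*)
  open import Relation.Binary.Reasoning.Setoid setoid

  module Σ = ListFold +-commutativeMonoid
  module Π = ListFold *-commutativeMonoid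

  𝟙 : Bool → Carrier
  𝟙 b = if b then 1# else 0#

  𝟙-∧ : ∀ b b′ → 𝟙 (b ∧ b′) ≈ 𝟙 b * 𝟙 b′
  𝟙-∧ false b′ = sym (zeroˡ _)
  𝟙-∧ true  b′ = sym (*-identityˡ _)

  if-else-0# : ∀ b x → (if b then x else 0#) ≈ 𝟙 b * x
  if-else-0# false x = sym (zeroˡ x)
  if-else-0# true  x = sym (*-identityˡ x)

  sumL-*ˡ : ∀ x (xs : List A) f → x * sumL xs f ≈ sumL xs (λ y → x * f y)
  sumL-*ˡ x []       f = zeroʳ x
  sumL-*ˡ x (y ∷ xs) f = trans (distribˡ x _ _) (+-congˡ (sumL-*ˡ x xs f))

  sumL-*ʳ : ∀ x (xs : List A) f → sumL xs f * x ≈ sumL xs (λ y → f y * x)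
  sumL-*ʳ x xs f = trans (*-comm _ x) (trans (sumL-*ˡ x xs f) (Σ.foldMap-cong xs λ y → *-comm x (f y)))

  sumL-filter : ∀ {P : A → Set p} (P? : ∀ x → Dec (P x)) xs f →
    sumL (List.filter P? xs) f ≈ sumL xs (λ x → 𝟙 (does (P? x)) * f x)
  sumL-filter P? []       f = refl
  sumL-filter P? (x ∷ xs) f with does (P? x)
  ... | true  = +-cong (sym (*-identityˡ _)) (sumL-filter P? xs f)
  ... | false = trans (sumL-filter P? xs f) (trans (sym (+-identityˡ _)) (+-congʳ (sym (zeroˡ _))))

  ofℕ-length-filter : ∀ {P : A → Set p} (P? : ∀ x → Dec (P x)) xs →
    ofℕ (List.length (List.filter P? xs)) ≈ sumL xs (λ x → 𝟙 (does (P? x)))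
  ofℕ-length-filter P? []       = refl
  ofℕ-length-filter P? (x ∷ xs) with does (P? x)
  ... | true  = +-congˡ (ofℕ-length-filter P? xs)
  ... | false = trans (ofℕ-length-filter P? xs) (sym (+-identityˡ _))

  ofℕ-+ : ∀ m n → ofℕ (m ℕ.+ n) ≈ ofℕ m + ofℕ n
  ofℕ-+ zero    n = sym (+-identityˡ _)
  ofℕ-+ (suc m) n = trans (+-congˡ (ofℕ-+ m n)) (sym (+-assoc _ _ _))

  ofℕ-* : ∀ m n → ofℕ (m ℕ.* n) ≈ ofℕ m * ofℕ n
  ofℕ-* zero    n = sym (zeroˡ _)
  ofℕ-* (suc m) n = begin
    ofℕ (n ℕ.+ m ℕ.* n)        ≈⟨ ofℕ-+ n (m ℕ.* n) ⟩
    ofℕ n + ofℕ (m ℕ.* n)      ≈⟨ +-cong (sym (*-identityˡ _)) (ofℕ-* m n) ⟩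
    1# * ofℕ n + ofℕ m * ofℕ n ≈⟨ distribʳ _ _ _ ⟨
    (1# + ofℕ m) * ofℕ n       ∎

  ofℕ-^ : ∀ m n → ofℕ (m ℕ.^ n) ≈ pow (ofℕ m) n
  ofℕ-^ m zero    = +-identityʳ 1#
  ofℕ-^ m (suc n) = trans (ofℕ-* m (m ℕ.^ n)) (*-congˡ (ofℕ-^ m n))

  pow-cong : ∀ {x y} n → x ≈ y → pow x n ≈ pow y n
  pow-cong zero    x≈y = refl
  pow-cong (suc n) x≈y = *-cong x≈y (pow-cong n x≈y)

  pow-+ : ∀ x m n → pow x (m ℕ.+ n) ≈ pow x m * pow x n
  pow-+ x zero    n = sym (*-identityˡ _)
  pow-+ x (suc m) n = trans (*-congˡ (pow-+ x m n)) (sym (*-assoc _ _ _))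

  pow-* : ∀ x m n → pow x (m ℕ.* n) ≈ pow (pow x n) m
  pow-* x zero    n = refl
  pow-* x (suc m) n = trans (pow-+ x n (m ℕ.* n)) (*-congˡ (pow-* x m n))

  pow-1# : ∀ n → pow 1# n ≈ 1#
  pow-1# zero    = refl
  pow-1# (suc n) = trans (*-identityˡ _) (pow-1# n)

  pow-sumℕ : ∀ x (xs : List A) f → pow x (sumℕ xs f) ≈ Π.foldMap xs (λ y → pow x (f y))
  pow-sumℕ x []       f = refl
  pow-sumℕ x (y ∷ xs) f = trans (pow-+ x (f y) _) (*-congˡ (pow-sumℕ x xs f))

  𝟙-all? : ∀ {n} {P : Fin n → Set p} (P? : ∀ x → Dec (P x)) → 𝟙 (does (all? P?)) ≈ ∏ (λ k → 𝟙 (does (P? k)))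
  𝟙-all? {n = zero}  P? = reflexive (≡.cong 𝟙 (dec-true (all? P?) λ ()))
  𝟙-all? {n = suc n} P? = begin
    𝟙 (does (all? P?))
      ≡⟨ ≡.cong 𝟙 (does-⇔ (⇔.sym Fin.∀-cons-⇔) (all? P?) (P? zero ×-dec all? (P? ∘ suc))) ⟩
    𝟙 (does (P? zero) ∧ does (all? (P? ∘ suc)))
      ≈⟨ 𝟙-∧ _ _ ⟩
    𝟙 (does (P? zero)) * 𝟙 (does (all? (P? ∘ suc)))
      ≈⟨ *-congˡ (𝟙-all? (P? ∘ suc)) ⟩
    ∏ (λ k → 𝟙 (does (P? k))) ∎

  sumL-vecs-∏ : ∀ (xs : List A) n (f : Fin n → A → Carrier) →
    sumL (vecs xs n) (λ w → ∏ (λ k → f k (Vec.lookup w k))) ≈ ∏ (λ k → sumL xs (f k))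
  sumL-vecs-∏ xs zero    f = +-identityʳ 1#
  sumL-vecs-∏ xs (suc n) f = begin
    sumL (vecs xs (suc n)) (λ w → ∏ (λ k → f k (Vec.lookup w k)))
      ≈⟨ Σ.foldMap-vecs-∷ xs n _ ⟩
    sumL xs (λ x → sumL (vecs xs n) (λ w → f zero x * ∏ (λ k → f (suc k) (Vec.lookup w k))))
      ≈⟨ Σ.foldMap-cong xs (λ x → sumL-*ˡ (f zero x) (vecs xs n) _) ⟨
    sumL xs (λ x → f zero x * sumL (vecs xs n) (λ w → ∏ (λ k → f (suc k) (Vec.lookup w k))))
      ≈⟨ Σ.foldMap-cong xs (λ x → *-congˡ (sumL-vecs-∏ xs n (f ∘ suc))) ⟩
    sumL xs (λ x → f zero x * ∏ (λ k → sumL xs (f (suc k))))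
      ≈⟨ sumL-*ʳ _ xs (f zero) ⟨
    ∏ (λ k → sumL xs (f k)) ∎

  offS? : ∀ {k} (S : Fin k → Bool) {P : Fin k → Set p} → (∀ i → Dec (P i)) → ∀ i → Dec (S i ≡ false → P i)
  offS? S P? i = (S i Bool.≟ false) →-dec P? i

  ∏-if : ∀ {k} (S : Fin k → Bool) x → ∏ (λ i → if S i then 1# else x) ≈ pow x ∣ not ∘ S ∣
  ∏-if {zero}  S x = refl
  ∏-if {suc k} S x with S zero
  ... | true  = trans (*-identityˡ _) (∏-if (S ∘ suc) x)
  ... | false = *-congˡ (∏-if (S ∘ suc) x)

  ∏-offSupport : ∀ {k} (S : Fin k → Bool) {P : Fin k → Set p} (P? : ∀ i → Dec (P i)) x →
    ∏ (λ i → if S i then 1# else 𝟙 (does (P? i)) * x) ≈ 𝟙 (does (all? (offS? S P?))) * pow x ∣ not ∘ S ∣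
  ∏-offSupport S P? x = begin
    ∏ (λ i → if S i then 1# else 𝟙 (does (P? i)) * x)
      ≈⟨ ∏-cong (λ i → split i (S i)) ⟩
    ∏ (λ i → 𝟙 (does (offS? S P? i)) * (if S i then 1# else x))
      ≈⟨ ∏-distrib-* (λ i → 𝟙 (does (offS? S P? i))) _ ⟩
    ∏ (λ i → 𝟙 (does (offS? S P? i))) * ∏ (λ i → if S i then 1# else x)
      ≈⟨ *-cong (sym (𝟙-all? (offS? S P?))) (∏-if S x) ⟩
    𝟙 (does (all? (offS? S P?))) * pow x ∣ not ∘ S ∣ ∎
    where
    split : ∀ i b →
      (if b then 1# else 𝟙 (does (P? i)) * x) ≈ 𝟙 (does ((b Bool.≟ false) →-dec P? i)) * (if b then 1# else x)
    split i true  = sym (*-identityˡ 1#)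
    split i false = refl

module RootsOfUnity {c ℓ} (R : CommutativeRing c ℓ) (domain : IsIntegralDomain R)
  (t : ℕ) .{{_ : ℕ.NonZero t}} (ε : CommutativeRing.Carrier R) (εPrimitive : RingDefs.IsPrimitiveRoot R t ε) where
  open CommutativeRing R hiding (zero)
  open RingDefs R
  open RingSums R
  open import Algebra.Properties.Semiring.Sum semiring using (sum; sum-cong-≋; sum-init-last; *-distribˡ-sum)
  open import Algebra.Properties.Group +-group using (∙-cancelʳ; x∙y⁻¹≈ε⇒x≈y)
  open import Algebra.Properties.Ring ring using ([y-z]x≈yx-zx)
  open import Relation.Binary.Reasoning.Setoid setoid

  geometricSum : ℕ → Carrier → Carrier
  geometricSum n x = sum {n} (λ j → pow x (toℕ j))

  geometricSum-suc : ∀ n x → geometricSum (suc n) x ≈ 1# + x * geometricSum n x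
  geometricSum-suc n x = +-congˡ (sym (*-distribˡ-sum {n} x (λ j → pow x (toℕ j))))

  geometricSum-snoc : ∀ n x → geometricSum (suc n) x ≈ geometricSum n x + pow x n
  geometricSum-snoc n x = trans (sum-init-last {n} (λ j → pow x (toℕ j))) (+-cong
    (sum-cong-≋ {n} λ j → reflexive (≡.cong (pow x) (toℕ-inject₁ j)))
    (reflexive (≡.cong (pow x) (toℕ-fromℕ n))))

  geometricSum-one : ∀ n {x} → x ≈ 1# → geometricSum n x ≈ ofℕ n
  geometricSum-one zero    x≈1 = refl
  geometricSum-one (suc n) x≈1 = trans (geometricSum-suc n _)
    (+-congˡ (trans (*-cong x≈1 (geometricSum-one n x≈1)) (*-identityˡ _)))

  -- (x - 1) ∑ xʲ = xⁿ - 1 = 0, and R has no zero divisors.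
  geometricSum-vanishes : ∀ n {x} → pow x n ≈ 1# → ¬ (x ≈ 1#) → geometricSum n x ≈ 0#
  geometricSum-vanishes n {x} xⁿ≈1 x≉1 with proj₂ domain (x - 1#) g [x-1]g≈0
    where
    g : Carrier
    g = geometricSum n x
    xg≈g : x * g ≈ g
    xg≈g = ∙-cancelʳ 1# (x * g) g (begin
      x * g + 1#       ≈⟨ +-comm _ _ ⟩
      1# + x * g       ≈⟨ geometricSum-suc n x ⟨
      geometricSum (suc n) x ≈⟨ geometricSum-snoc n x ⟩
      g + pow x n      ≈⟨ +-congˡ xⁿ≈1 ⟩
      g + 1#           ∎)
    [x-1]g≈0 : (x - 1#) * g ≈ 0#
    [x-1]g≈0 = begin
      (x - 1#) * g     ≈⟨ [y-z]x≈yx-zx g x 1# ⟩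
      x * g - 1# * g   ≈⟨ +-cong xg≈g (-‿cong (*-identityˡ g)) ⟩
      g - g            ≈⟨ -‿inverseʳ g ⟩
      0#               ∎
  ... | inj₁ x-1≈0 = contradiction (x∙y⁻¹≈ε⇒x≈y x 1# x-1≈0) x≉1
  ... | inj₂ g≈0  = g≈0

  pow-ε-multiple : ∀ q → pow ε (q ℕ.* t) ≈ 1#
  pow-ε-multiple q = trans (pow-* ε q t) (trans (pow-cong q (proj₁ εPrimitive)) (pow-1# q))

  pow-ε-mod : ∀ E → pow ε E ≈ pow ε (E % t)
  pow-ε-mod E = begin
    pow ε E                              ≡⟨ ≡.cong (pow ε) (m≡m%n+[m/n]*n E t) ⟩
    pow ε (E % t ℕ.+ (E / t) ℕ.* t)      ≈⟨ pow-+ ε (E % t) _ ⟩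
    pow ε (E % t) * pow ε ((E / t) ℕ.* t) ≈⟨ *-congˡ (pow-ε-multiple (E / t)) ⟩
    pow ε (E % t) * 1#                   ≈⟨ *-identityʳ _ ⟩
    pow ε (E % t)                        ∎

  pow-ε≉1 : ∀ E → ¬ (t ∣ℕ E) → ¬ (pow ε E ≈ 1#)
  pow-ε≉1 E t∤E εᴱ≈1 with E % t ℕ.≟ 0
  ... | yes E%t≡0 = t∤E (m%n≡0⇒n∣m E t E%t≡0)
  ... | no  E%t≢0 = proj₂ εPrimitive (E % t) (ℕ.n≢0⇒n>0 E%t≢0) (m%n<n E t) (trans (sym (pow-ε-mod E)) εᴱ≈1)

  orthogonality : ∀ E → sumL (List.allFin t) (λ j → pow ε (toℕ j ℕ.* E)) ≈ 𝟙 (does (t ∣ℕ? E)) * ofℕ t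
  orthogonality E = begin
    sumL (List.allFin t) (λ j → pow ε (toℕ j ℕ.* E)) ≈⟨ Σ.foldMap-cong (List.allFin t) (λ j → pow-* ε (toℕ j) E) ⟩
    sumL (List.allFin t) (λ j → pow εᴱ (toℕ j))       ≡⟨ Σ.foldMap-tabulate t (λ j → j) _ ⟩
    geometricSum t εᴱ                                  ≈⟨ value (t ∣ℕ? E) ⟩
    𝟙 (does (t ∣ℕ? E)) * ofℕ t                          ∎
    where
    εᴱ : Carrier
    εᴱ = pow ε E
    εᴱᵗ≈1 : pow εᴱ t ≈ 1#
    εᴱᵗ≈1 = trans (sym (pow-* ε t E)) (trans (reflexive (≡.cong (pow ε) (ℕ.*-comm t E))) (pow-ε-multiple E))
    value : (d : Dec (t ∣ℕ E)) → geometricSum t εᴱ ≈ 𝟙 (does d) * ofℕ t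
    value (yes (divides q ≡.refl)) = trans (geometricSum-one t (pow-ε-multiple q)) (sym (*-identityˡ _))
    value (no t∤E) = trans (geometricSum-vanishes t εᴱᵗ≈1 (pow-ε≉1 E t∤E)) (sym (zeroˡ _))

module Walks (G : Graph) where
  open GraphDefs G

  Consecutive : Rel OE _
  Consecutive e e′ = start e′ ≡ end e

  consecutive? : Decidable Consecutive
  consecutive? e e′ = start e′ ≟ end e

  FeedsInto : Rel OE _
  FeedsInto e e′ = e′ ≢ inv e × end e ≡ start e′

  feedsInto? : Decidable FeedsInto
  feedsInto? e e′ = ¬? (e′ ≟OE inv e) ×-dec (end e ≟ start e′)

  start-inv : ∀ e → start (inv e) ≡ end e
  start-inv (_ , true)  = ≡.refl
  start-inv (_ , false) = ≡.refl

  end-inv : ∀ e → end (inv e) ≡ start e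
  end-inv (_ , true)  = ≡.refl
  end-inv (_ , false) = ≡.refl

  inv-involutive : ∀ e → inv (inv e) ≡ e
  inv-involutive (_ , true)  = ≡.refl
  inv-involutive (_ , false) = ≡.refl

  e≢inv-e : ∀ e → e ≢ inv e
  e≢inv-e (_ , true)  ()
  e≢inv-e (_ , false) ()

  -- IsClosedWalk v unfolds to Cyclic Consecutive v.
  closedWalk⇔ : ∀ (v : Vec OE (suc l)) → IsClosedWalk v ⇔ Pointwise Consecutive v (rotate v)
  closedWalk⇔ = cyclic⇔pointwise-rotate Consecutive

  circuit⇔ : ∀ (v : Vec OE (suc l)) → IsCircuit v ⇔ Pointwise FeedsInto v (rotate v)
  circuit⇔ v = ⇔.trans
    (mk⇔ (λ (closed , noBacktrack) i → noBacktrack i , ≡.sym (closed i))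
         (λ feeds → (λ i → ≡.sym (proj₂ (feeds i))) , (λ i → proj₁ (feeds i))))
    (cyclic⇔pointwise-rotate FeedsInto v)

  anyOE? : ∀ {p} {P : OE → Set p} → (∀ e → Dec (P e)) → Dec (∃ P)
  anyOE? P? = Dec.map
    (mk⇔ (λ { (k , inj₁ p) → (k , true) , p ; (k , inj₂ p) → (k , false) , p })
         (λ { ((k , true) , p) → k , inj₁ p ; ((k , false) , p) → k , inj₂ p }))
    (any? λ k → P? (k , true) ⊎-dec P? (k , false))

  _∈ₑ_ : OE → (Fin m → Bool) → Set
  e ∈ₑ S = S (proj₁ e) ≡ true

  _∈ₑ?_ : ∀ e S → Dec (e ∈ₑ S)
  e ∈ₑ? S = S (proj₁ e) Bool.≟ true

  Acyclic : (Fin m → Bool) → Set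
  Acyclic S = ∀ l (w : Vec OE (suc l)) → (∀ i → lookup w i ∈ₑ S) → ¬ IsCircuit w

  NonBacktracking : (ℕ → OE) → Set
  NonBacktracking a = ∀ k → FeedsInto (a k) (a (suc k))

  Continuable : (OE → Set) → Set
  Continuable F = ∀ e → F e → ∃ λ e′ → F e′ × FeedsInto e e′

  NoInfiniteWalk : (Fin m → Bool) → Set
  NoInfiniteWalk S = ∀ a → (∀ k → a k ∈ₑ S) → ¬ NonBacktracking a

  noLoop : ∀ {S e} → NoInfiniteWalk S → e ∈ₑ S → start e ≢ end e
  noLoop {e = e} noWalk e∈S loop = noWalk (λ _ → e) (λ _ → e∈S) (λ _ → e≢inv-e e , ≡.sym loop)

  same-edge : ∀ f e → proj₁ f ≡ proj₁ e → f ≡ e ⊎ f ≡ inv e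
  same-edge (k , b) (.k , b′) ≡.refl with b Bool.≟ b′
  ... | yes ≡.refl = inj₁ ≡.refl
  ... | no  b≢b′   = inj₂ (≡.cong (k ,_) (Bool.¬-not b≢b′))

  reach-firstEdge : ∀ {S x y} → Reach S x y → x ≢ y → ∃ λ e → e ∈ₑ S
  reach-firstEdge (here _)       x≢x = contradiction ≡.refl x≢x
  reach-firstEdge (step e e∈S _) _   = e , e∈S

  module _ {S : Fin m → Bool} (acyclic : Acyclic S) where

    -- A closed non-backtracking segment either has no tail, and is then a circuit, or
    -- its first and last edges cancel and the segment strictly inside is closed.
    noClosedSegment : ∀ b → (∀ k → b k ∈ₑ S) → NonBacktracking b → ∀ d → start (b 0) ≢ start (b (suc d))
    noClosedSegment b b∈S nb d closes with b d ≟OE inv (b 0)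
    ... | no noTail =
      acyclic d (tabulate (b ∘ toℕ)) inS (Equivalence.from (circuit⇔ _) (tabulate-linked FeedsInto b d (b 0) nb closing))
      where
      inS : ∀ i → lookup (tabulate (b ∘ toℕ)) i ∈ₑ S
      inS i = ≡.subst (_∈ₑ S) (≡.sym (lookup∘tabulate (b ∘ toℕ) i)) (b∈S (toℕ i))
      closing : FeedsInto (b d) (b 0)
      closing = (λ b₀≡b⁻¹ → noTail (≡.trans (≡.sym (inv-involutive _)) (≡.cong inv (≡.sym b₀≡b⁻¹))))
              , ≡.sym (≡.trans closes (≡.sym (proj₂ (nb d))))
    ... | yes tail = backtracked d tail
      where
      backtracked : ∀ d → b d ≡ inv (b 0) → ⊥
      backtracked zero          tail = e≢inv-e (b 0) tail
      backtracked (suc zero)    tail = proj₁ (nb 0) tail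
      backtracked (suc (suc d)) tail = noClosedSegment (b ∘ suc) (b∈S ∘ suc) (nb ∘ suc) d
        (≡.trans (≡.sym (proj₂ (nb 0))) (≡.trans (≡.sym (start-inv (b 0))) (≡.cong start (≡.sym tail))))

    acyclic⇒noInfiniteWalk : NoInfiniteWalk S
    acyclic⇒noInfiniteWalk a a∈S nb with pigeonhole (ℕ.n<1+n n) (λ (i : Fin (suc n)) → start (a (toℕ i)))
    ... | i , j , i<j , same with ℕ.m≤n⇒∃[o]m+o≡n i<j
    ...   | d , i+1+d≡j = noClosedSegment (λ k → a (k ℕ.+ toℕ i)) (λ k → a∈S _) (λ k → nb _) d
      (≡.trans same (≡.cong (start ∘ a) (≡.sym (≡.trans (≡.cong suc (ℕ.+-comm d (toℕ i))) i+1+d≡j))))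

  continuable⇒empty : ∀ {S F} → NoInfiniteWalk S → (∀ e → F e → e ∈ₑ S) → Continuable F → ∀ e → ¬ F e
  continuable⇒empty {S} {F} noWalk F⊆S continue e Fe =
    noWalk (proj₁ ∘ walk) (λ k → F⊆S _ (proj₂ (walk k))) λ k → proj₂ (proj₂ (continue _ (proj₂ (walk k))))
    where
    walk : ℕ → ∃ F
    walk zero    = e , Fe
    walk (suc k) = let e′ , Fe′ , _ = continue _ (proj₂ (walk k)) in e′ , Fe′

  IsLeaf : (Fin m → Bool) → OE → Set
  IsLeaf S e = e ∈ₑ S × (∀ e′ → e′ ∈ₑ S → start e′ ≡ start e → e′ ≡ e)

  -- Either some edge of S cannot be continued inside S, and its reverse is a leaf,
  -- or S is continuable, hence has no edges.
  leaf-exists : ∀ {S} → NoInfiniteWalk S → (∃ λ e → e ∈ₑ S) → ∃ (IsLeaf S)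
  leaf-exists {S} noWalk (e , e∈S) with anyOE? (λ f → (f ∈ₑ? S) ×-dec ¬? (anyOE? (continuation? f)))
    where
    continuation? : ∀ f e′ → Dec (e′ ∈ₑ S × FeedsInto f e′)
    continuation? f e′ = (e′ ∈ₑ? S) ×-dec feedsInto? f e′
  ... | yes (f , f∈S , stuck) = inv f , f∈S , only
    where
    only : ∀ e′ → e′ ∈ₑ S → start e′ ≡ start (inv f) → e′ ≡ inv f
    only e′ e′∈S same with e′ ≟OE inv f
    ... | yes e′≡f⁻¹ = e′≡f⁻¹
    ... | no  e′≢f⁻¹ = contradiction (e′ , e′∈S , e′≢f⁻¹ , ≡.sym (≡.trans same (start-inv f))) stuck
  ... | no noStuck = contradiction e∈S (continuable⇒empty noWalk (λ _ f∈S → f∈S) continue e)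
    where
    continue : Continuable (_∈ₑ S)
    continue f f∈S with anyOE? (λ e′ → (e′ ∈ₑ? S) ×-dec feedsInto? f e′)
    ... | yes c = c
    ... | no ¬c = contradiction (f , f∈S , ¬c) noStuck

-- Trees

mkGraph : ∀ {n m} → (Fin m → Fin n) → (Fin m → Fin n) → Graph
mkGraph {n} {m} src tgt = record { n = n ; m = m ; src = src ; tgt = tgt }

module LeafContraction {n m} (src tgt : Fin (suc m) → Fin (suc (suc n))) (T : Fin (suc m) → Bool)
  (forest : Walks.NoInfiniteWalk (mkGraph src tgt) T) (e : GraphDefs.OE (mkGraph src tgt))
  (leaf : Walks.IsLeaf (mkGraph src tgt) T e) where
  open GraphDefs (mkGraph src tgt) hiding (n; m; src; tgt)
  open Walks (mkGraph src tgt)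

  private
    v : Fin (suc (suc n))
    v = start e
    kₑ : Fin (suc m)
    kₑ = proj₁ e

  v≢u : v ≢ end e
  v≢u = noLoop {T} {e} forest (proj₁ leaf)

  -- Contracting e merges the leaf v = start e into its neighbour end e.
  squash : Fin (suc (suc n)) → Fin (suc n)
  squash x with v ≟ x
  ... | yes _   = punchOut v≢u
  ... | no  v≢x = punchOut v≢x

  squash-≢ : ∀ {x} (v≢x : v ≢ x) → squash x ≡ punchOut v≢x
  squash-≢ {x} v≢x with v ≟ x
  ... | yes v≡x = contradiction v≡x v≢x
  ... | no  _   = Fin.punchOut-cong v ≡.refl

  squash-e : squash v ≡ squash (end e)
  squash-e with v ≟ v
  ... | yes _ = ≡.sym (squash-≢ v≢u)
  ... | no v≢v = contradiction ≡.refl v≢v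

  G′ : Graph
  G′ = record { n = suc n ; m = m ; src = squash ∘ src ∘ punchIn kₑ ; tgt = squash ∘ tgt ∘ punchIn kₑ }
  module G′ = GraphDefs G′
  module W′ = Walks G′

  T′ : Fin m → Bool
  T′ = T ∘ punchIn kₑ

  lift : G′.OE → OE
  lift (k , b) = punchIn kₑ k , b

  start′ : ∀ f → G′.start f ≡ squash (start (lift f))
  start′ (_ , true)  = ≡.refl
  start′ (_ , false) = ≡.refl

  end′ : ∀ f → G′.end f ≡ squash (end (lift f))
  end′ (_ , true)  = ≡.refl
  end′ (_ , false) = ≡.refl

  squash-ends : ∀ f → proj₁ f ≡ kₑ → squash (start f) ≡ squash (end f)
  squash-ends f f~e with same-edge f e f~e
  ... | inj₁ ≡.refl = squash-e
  ... | inj₂ ≡.refl =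
    ≡.sym (≡.subst₂ (λ x y → squash y ≡ squash x) (≡.sym (start-inv e)) (≡.sym (end-inv e)) squash-e)

  reach-squash : ∀ {x y} → Reach T x y → G′.Reach T′ (squash x) (squash y)
  reach-squash (here x) = G′.here (squash x)
  reach-squash (step f f∈T r) with proj₁ f ≟ kₑ
  ... | yes f~e = ≡.subst (λ z → G′.Reach T′ z _) (≡.sym (squash-ends f f~e)) (reach-squash r)
  ... | no  f≁e = ≡.subst (λ z → G′.Reach T′ z _) (≡.trans (start′ f′) (≡.cong (squash ∘ start) lift-f′))
      (G′.step f′ (≡.trans (≡.cong (T ∘ proj₁) lift-f′) f∈T)
        (≡.subst (λ z → G′.Reach T′ z _) (≡.sym (≡.trans (end′ f′) (≡.cong (squash ∘ end) lift-f′)))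
          (reach-squash r)))
    where
    f′ : G′.OE
    f′ = punchOut (f≁e ∘ ≡.sym) , proj₂ f
    lift-f′ : lift f′ ≡ f
    lift-f′ = ≡.cong (_, proj₂ f) (Fin.punchIn-punchOut (f≁e ∘ ≡.sym))

  contracted-connected : ConnectedVia T → G′.ConnectedVia T′
  contracted-connected connected x y = ≡.subst₂ (G′.Reach T′) (squash-punchIn x) (squash-punchIn y)
    (reach-squash (connected (punchIn v x) (punchIn v y)))
    where
    squash-punchIn : ∀ x → squash (punchIn v x) ≡ x
    squash-punchIn x = ≡.trans (squash-≢ (Fin.punchInᵢ≢i v x ∘ ≡.sym)) (Fin.punchOut-punchIn v)

  start≢v : ∀ f → f ∈ₑ T → proj₁ f ≢ kₑ → v ≢ start f
  start≢v f f∈T f≁e v≡start = f≁e (≡.cong proj₁ (proj₂ leaf f f∈T (≡.sym v≡start)))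

  end≢v : ∀ f → f ∈ₑ T → proj₁ f ≢ kₑ → v ≢ end f
  end≢v f f∈T f≁e v≡end = start≢v (inv f) f∈T f≁e (≡.trans v≡end (≡.sym (start-inv f)))

  contracted-forest : W′.NoInfiniteWalk T′
  contracted-forest a′ a′∈T′ nb′ = forest (lift ∘ a′) a′∈T′ nb
    where
    nb : NonBacktracking (lift ∘ a′)
    nb k = (λ eq → proj₁ (nb′ k) (≡.cong₂ _,_ (Fin.punchIn-injective kₑ _ _ (≡.cong proj₁ eq)) (≡.cong proj₂ eq)))
         , Fin.punchOut-injective (end≢v (lift (a′ k)) (a′∈T′ k) (Fin.punchInᵢ≢i kₑ _))
             (start≢v (lift (a′ (suc k))) (a′∈T′ (suc k)) (Fin.punchInᵢ≢i kₑ _))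
             (≡.trans (≡.sym (squash-≢ _)) (≡.trans (≡.sym (end′ (a′ k)))
               (≡.trans (proj₂ (nb′ k)) (≡.trans (start′ (a′ (suc k))) (squash-≢ _)))))

  ∣T∣≡1+∣T′∣ : ∣ T ∣ ≡ suc ∣ T′ ∣
  ∣T∣≡1+∣T′∣ = ≡.trans (ℕΣ.sum-remove {i = kₑ} (λ k → if T k then 1 else 0))
    (≡.cong (λ b → (if b then 1 else 0) ℕ.+ ∣ T′ ∣) (proj₁ leaf))

treeSize : ∀ (G : Graph) (T : Fin (Graph.m G) → Bool) → Fin (Graph.n G) →
  GraphDefs.ConnectedVia G T → Walks.NoInfiniteWalk G T → suc ∣ T ∣ ≡ Graph.n G
treeSize G = go (Graph.n G) (Graph.src G) (Graph.tgt G)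
  where
  go : ∀ n {m} (src tgt : Fin m → Fin n) (T : Fin m → Bool) → Fin n →
    GraphDefs.ConnectedVia (mkGraph src tgt) T → Walks.NoInfiniteWalk (mkGraph src tgt) T → suc ∣ T ∣ ≡ n
  go (suc zero) src tgt T _ _ forest = ≡.cong suc (∣S∣≡0 T notInT)
    where
    notInT : ∀ k → T k ≡ false
    notInT k with T k in k∈T
    ... | false = ≡.refl
    ... | true  = contradiction (λ _ → (λ ()) , fin1 (tgt k) (src k)) (forest (λ _ → k , true) (λ _ → k∈T))
      where
      fin1 : (x y : Fin 1) → x ≡ y
      fin1 zero zero = ≡.refl
  go (suc (suc n)) {zero}  src tgt T _ connected forest with Walks.reach-firstEdge _ (connected zero (suc zero)) (λ ())
  ... | (() , _) , _
  go (suc (suc n)) {suc m} src tgt T _ connected forest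
    with Walks.leaf-exists _ forest (Walks.reach-firstEdge _ (connected zero (suc zero)) (λ ()))
  ... | e , leaf = ≡.cong suc (≡.trans ∣T∣≡1+∣T′∣ (go (suc n) _ _ T′ zero (contracted-connected connected) contracted-forest))
    where open LeafContraction src tgt T forest e leaf

∣∁T∣≡genus : ∀ (G : Graph) (T : Fin (Graph.m G) → Bool) → Fin (Graph.n G) →
  GraphDefs.ConnectedVia G T → Walks.NoInfiniteWalk G T → ∣ not ∘ T ∣ ≡ GraphDefs.genus G
∣∁T∣≡genus G T x connected forest = ≡.sym (begin
  m ℕ.+ 1 ∸ n                   ≡⟨ ≡.cong₂ _∸_ (ℕ.+-comm m 1) (≡.sym (treeSize G T x connected forest)) ⟩
  m ∸ ∣ T ∣                     ≡⟨ ≡.cong (_∸ ∣ T ∣) (≡.sym (∣S∣+∣∁S∣≡m T)) ⟩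
  ∣ T ∣ ℕ.+ ∣ not ∘ T ∣ ∸ ∣ T ∣ ≡⟨ ℕ.m+n∸m≡n ∣ T ∣ _ ⟩
  ∣ not ∘ T ∣                   ∎)
  where
  open ≡.≡-Reasoning
  open Graph G

-- Integer chains

open import Data.Integer.Base using (_-_; -_)

module ℤL = ListFold ℤ.+-0-commutativeMonoid

sumℤ-− : ∀ (xs : List A) f g → sumℤ xs (λ x → f x - g x) ≡ sumℤ xs f - sumℤ xs g
sumℤ-− []       f g = ≡.refl
sumℤ-− (x ∷ xs) f g = ≡.trans (≡.cong (λ s → (f x - g x) ℤ.+ s) (sumℤ-− xs f g)) (rearrange (f x) (g x) _ _)
  where
  rearrange : ∀ a b c d → (a - b) ℤ.+ (c - d) ≡ (a ℤ.+ c) - (b ℤ.+ d)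
  rearrange = solve-∀

module _ (t : ℕ) where

  ∣-sum : ∀ {n} (g : Fin n → ℤ) → (∀ k → + t ∣ g k) → + t ∣ ℤΣ.sum g
  ∣-sum {zero}  g t∣g = ℤ∣.divides (+ 0) ≡.refl
  ∣-sum {suc n} g t∣g = ℤ∣.∣m∣n⇒∣m+n (t∣g zero) (∣-sum (g ∘ suc) (t∣g ∘ suc))

  ∣-sum-except : ∀ {n} (g : Fin n → ℤ) k₀ → (∀ k → k ≢ k₀ → + t ∣ g k) →
    + t ∣ sumℤ (List.allFin n) g → + t ∣ g k₀
  ∣-sum-except {suc n} g k₀ others t∣Σ = ℤ∣.∣m+n∣n⇒∣m
    (≡.subst (+ t ∣_) (≡.trans (ℤL.foldMap-tabulate (suc n) (λ k → k) g) (ℤΣ.sum-remove {i = k₀} g)) t∣Σ)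
    (∣-sum (g ∘ punchIn k₀) (λ k → others _ (punchInᵢ≢i k₀ k)))

module Chains (G : Graph) where
  open GraphDefs G
  open Walks G

  edgeChain : OE → Fin m → ℤ
  edgeChain (k′ , b) k = if does (k′ ≟ k) then (if b then + 1 else - (+ 1)) else + 0

  abCoeff-∷ : ∀ {l} a (w : Vec OE l) k → abCoeff (a ∷ w) k ≡ edgeChain a k ℤ.+ abCoeff w k
  abCoeff-∷ (k′ , b) w k with does (k′ ≟ k)
  ... | false = ≡.refl
  ... | true with b
  ...   | true  = ≡.refl
  ...   | false = ≡.refl

  flowAt : (Fin m → Fin n) → (Fin m → ℤ) → Fin n → ℤ
  flowAt ep f x = sumℤ (List.allFin m) (λ k → if does (ep k ≟ x) then f k else + 0)

  ∂ : (Fin m → ℤ) → Fin n → ℤ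
  ∂ f x = flowAt src f x - flowAt tgt f x

  δ : Fin n → Fin n → ℤ
  δ y x = if does (y ≟ x) then + 1 else + 0

  flowAt-zero : ∀ ep x → flowAt ep (λ _ → + 0) x ≡ + 0
  flowAt-zero ep x =
    ≡.trans (ℤL.foldMap-cong (List.allFin m) λ k → if-same (does (ep k ≟ x))) (ℤL.foldMap-ε (List.allFin m))
    where
    if-same : ∀ b → (if b then + 0 else + 0) ≡ + 0
    if-same true  = ≡.refl
    if-same false = ≡.refl

  flowAt-+ : ∀ ep f g x → flowAt ep (λ k → f k ℤ.+ g k) x ≡ flowAt ep f x ℤ.+ flowAt ep g x
  flowAt-+ ep f g x = ≡.trans (ℤL.foldMap-cong (List.allFin m) (λ k → if-+ (does (ep k ≟ x))))
    (ℤL.foldMap-∙ (List.allFin m) (λ k → if does (ep k ≟ x) then f k else + 0)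
                                  (λ k → if does (ep k ≟ x) then g k else + 0))
    where
    if-+ : ∀ {k} b → (if b then f k ℤ.+ g k else + 0) ≡ (if b then f k else + 0) ℤ.+ (if b then g k else + 0)
    if-+ true  = ≡.refl
    if-+ false = ≡.refl

  flowAt-edgeChain : ∀ ep k′ b x →
    flowAt ep (edgeChain (k′ , b)) x ≡ (if does (ep k′ ≟ x) then (if b then + 1 else - (+ 1)) else + 0)
  flowAt-edgeChain ep k′ b x = ≡.trans (ℤL.foldMap-allFin-single k′ off) (on (k′ ≟ k′))
    where
    off : ∀ k → k ≢ k′ → (if does (ep k ≟ x) then edgeChain (k′ , b) k else + 0) ≡ + 0
    off k k≢k′ with k′ ≟ k | does (ep k ≟ x)
    ... | yes k′≡k | _     = contradiction (≡.sym k′≡k) k≢k′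
    ... | no _     | true  = ≡.refl
    ... | no _     | false = ≡.refl
    on : (d : Dec (k′ ≡ k′)) → (if does (ep k′ ≟ x) then (if does d then (if b then + 1 else - (+ 1)) else + 0) else + 0)
                               ≡ (if does (ep k′ ≟ x) then (if b then + 1 else - (+ 1)) else + 0)
    on (yes _)   = ≡.refl
    on (no k′≢k′) = contradiction ≡.refl k′≢k′

  ∂-cong : ∀ {f g} → (∀ k → f k ≡ g k) → ∀ x → ∂ f x ≡ ∂ g x
  ∂-cong f≗g x = ≡.cong₂ _-_ (flowAt-cong src) (flowAt-cong tgt)
    where
    flowAt-cong : ∀ ep → flowAt ep _ x ≡ flowAt ep _ x
    flowAt-cong ep = ℤL.foldMap-cong (List.allFin m) λ k → ≡.cong (λ z → if does (ep k ≟ x) then z else + 0) (f≗g k)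

  ∂-+ : ∀ f g x → ∂ (λ k → f k ℤ.+ g k) x ≡ ∂ f x ℤ.+ ∂ g x
  ∂-+ f g x = ≡.trans (≡.cong₂ _-_ (flowAt-+ src f g x) (flowAt-+ tgt f g x))
    (rearrange (flowAt src f x) (flowAt src g x) (flowAt tgt f x) (flowAt tgt g x))
    where
    rearrange : ∀ a b c d → (a ℤ.+ b) - (c ℤ.+ d) ≡ (a - c) ℤ.+ (b - d)
    rearrange = solve-∀

  flowAt-− : ∀ ep f g x → flowAt ep (λ k → f k - g k) x ≡ flowAt ep f x - flowAt ep g x
  flowAt-− ep f g x = ≡.trans (ℤL.foldMap-cong (List.allFin m) (λ k → if-− (does (ep k ≟ x))))
    (sumℤ-− (List.allFin m) (λ k → if does (ep k ≟ x) then f k else + 0) (λ k → if does (ep k ≟ x) then g k else + 0))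
    where
    if-− : ∀ {k} b → (if b then f k - g k else + 0) ≡ (if b then f k else + 0) - (if b then g k else + 0)
    if-− true  = ≡.refl
    if-− false = ≡.refl

  ∂-− : ∀ f g x → ∂ (λ k → f k - g k) x ≡ ∂ f x - ∂ g x
  ∂-− f g x = ≡.trans (≡.cong₂ _-_ (flowAt-− src f g x) (flowAt-− tgt f g x))
    (rearrange (flowAt src f x) (flowAt src g x) (flowAt tgt f x) (flowAt tgt g x))
    where
    rearrange : ∀ a b c d → (a - b) - (c - d) ≡ (a - c) - (b - d)
    rearrange = solve-∀

  ∂-edgeChain : ∀ e x → ∂ (edgeChain e) x ≡ δ (start e) x - δ (end e) x
  ∂-edgeChain (k , b) x rewrite flowAt-edgeChain src k b x | flowAt-edgeChain tgt k b x with b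
  ... | true  with does (src k ≟ x) | does (tgt k ≟ x)
  ...   | true  | true  = ≡.refl
  ...   | true  | false = ≡.refl
  ...   | false | true  = ≡.refl
  ...   | false | false = ≡.refl
  ∂-edgeChain (k , b) x | false with does (src k ≟ x) | does (tgt k ≟ x)
  ...   | true  | true  = ≡.refl
  ...   | true  | false = ≡.refl
  ...   | false | true  = ≡.refl
  ...   | false | false = ≡.refl

  ∂-abCoeff : ∀ {l} (w : Vec OE l) x → ∂ (abCoeff w) x ≡ sumℤ (toList w) (λ e → δ (start e) x - δ (end e) x)
  ∂-abCoeff Vec.[] x = ≡.cong₂ _-_ (flowAt-zero src x) (flowAt-zero tgt x)
  ∂-abCoeff (e ∷ w) x = begin
    ∂ (abCoeff (e ∷ w)) x                          ≡⟨ ∂-cong (abCoeff-∷ e w) x ⟩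
    ∂ (λ k → edgeChain e k ℤ.+ abCoeff w k) x      ≡⟨ ∂-+ (edgeChain e) (abCoeff w) x ⟩
    ∂ (edgeChain e) x ℤ.+ ∂ (abCoeff w) x          ≡⟨ ≡.cong₂ ℤ._+_ (∂-edgeChain e x) (∂-abCoeff w x) ⟩
    sumℤ (toList (e ∷ w)) (λ e → δ (start e) x - δ (end e) x) ∎
    where open ≡.≡-Reasoning

  closedWalk⇒∂≡0 : ∀ {l} (w : Vec OE (suc l)) → IsClosedWalk w → ∀ x → ∂ (abCoeff w) x ≡ + 0
  closedWalk⇒∂≡0 w closed x = begin
    ∂ (abCoeff w) x                                         ≡⟨ ∂-abCoeff w x ⟩
    sumℤ (toList w) (λ e → δ (start e) x - δ (end e) x)     ≡⟨ sumℤ-− (toList w) (λ e → δ (start e) x) _ ⟩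
    starts - sumℤ (toList w) (λ e → δ (end e) x)            ≡⟨ ≡.cong (λ s → starts - s) ends≡starts ⟩
    starts - starts                                         ≡⟨ ℤ.+-inverseʳ starts ⟩
    + 0                                                     ∎
    where
    open ≡.≡-Reasoning
    starts : ℤ
    starts = sumℤ (toList w) (λ e → δ (start e) x)
    ends≡starts : sumℤ (toList w) (λ e → δ (end e) x) ≡ starts
    ends≡starts = ≡.trans
      (ℤL.foldMap-pointwise (λ e → δ (end e) x) (λ e → δ (start e) x)
        (λ consecutive → ≡.cong (λ y → δ y x) (≡.sym consecutive)) (Equivalence.to (closedWalk⇔ w) closed))
      (ℤL.foldMap-rotate w (λ e → δ (start e) x))

  module _ (t : ℕ) {T : Fin m → Bool} (forest : NoInfiniteWalk T) (β : Fin m → ℤ)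
           (balanced : ∀ x → + t ∣ ∂ β x) (offT : ∀ k → T k ≡ false → + t ∣ β k) where

    private
      termAt : Fin n → Fin m → ℤ
      termAt x k = (if does (src k ≟ x) then β k else + 0) - (if does (tgt k ≟ x) then β k else + 0)

      ∂≡ΣtermAt : ∀ x → ∂ β x ≡ sumℤ (List.allFin m) (termAt x)
      ∂≡ΣtermAt x = ≡.sym (sumℤ-− (List.allFin m)
        (λ k → if does (src k ≟ x) then β k else + 0) (λ k → if does (tgt k ≟ x) then β k else + 0))

      ownTerm : ∀ f → start f ≢ end f → + t ∣ termAt (end f) (proj₁ f) → + t ∣ β (proj₁ f)
      ownTerm (k , true) start≢end t∣term with src k ≟ tgt k | tgt k ≟ tgt k
      ... | yes loop | _          = contradiction loop start≢end
      ... | no _     | no tgt≢tgt = contradiction ≡.refl tgt≢tgt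
      ... | no _     | yes _      =
        ≡.subst (+ t ∣_) (ℤ.neg-involutive (β k)) (ℤ∣.∣m⇒∣-m (≡.subst (+ t ∣_) (ℤ.+-identityˡ (- β k)) t∣term))
      ownTerm (k , false) start≢end t∣term with src k ≟ src k | tgt k ≟ src k
      ... | no src≢src | _        = contradiction ≡.refl src≢src
      ... | yes _      | yes loop = contradiction loop start≢end
      ... | yes _      | no _     = ≡.subst (+ t ∣_) (ℤ.+-identityʳ (β k)) t∣term

    -- If β ≡ 0 on every continuation of f, conservation at end f leaves only the term of f.
    stuck⇒divisible : ∀ f → f ∈ₑ T → (∀ e′ → FeedsInto f e′ → + t ∣ β (proj₁ e′)) → + t ∣ β (proj₁ f)
    stuck⇒divisible f f∈T continuations = ownTerm f (noLoop {T} {f} forest f∈T)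
      (∣-sum-except t (termAt (end f)) (proj₁ f) others (≡.subst (+ t ∣_) (∂≡ΣtermAt (end f)) (balanced (end f))))
      where
      others : ∀ k → k ≢ proj₁ f → + t ∣ termAt (end f) k
      others k k≢f = ℤ∣.∣m∣n⇒∣m-n (leaving true (src k ≟ end f)) (leaving false (tgt k ≟ end f))
        where
        leaving : ∀ b → (d : Dec (start (k , b) ≡ end f)) → + t ∣ (if does d then β k else + 0)
        leaving b (yes starts) = continuations (k , b) ((λ e′≡f⁻¹ → k≢f (≡.cong proj₁ e′≡f⁻¹)) , ≡.sym starts)
        leaving b (no _)       = ℤ∣.divides (+ 0) ≡.refl

    cycle-vanishes : ∀ k → + t ∣ β k
    cycle-vanishes k with + t ∣? β k
    ... | yes t∣βk = t∣βk
    ... | no  t∤βk = contradiction t∤βk (continuable⇒empty forest Bad⊆T continue (k , true))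
      where
      Bad : OE → Set
      Bad e = ¬ (+ t ∣ β (proj₁ e))
      Bad⊆T : ∀ e → Bad e → e ∈ₑ T
      Bad⊆T e bad with T (proj₁ e) in e∈T
      ... | true  = ≡.refl
      ... | false = contradiction (offT _ e∈T) bad
      continue : Continuable Bad
      continue f bad with anyOE? (λ e′ → ¬? (+ t ∣? β (proj₁ e′)) ×-dec feedsInto? f e′)
      ... | yes c    = c
      ... | no  none = contradiction (stuck⇒divisible f (Bad⊆T f bad) good) bad
        where
        good : ∀ e′ → FeedsInto f e′ → + t ∣ β (proj₁ e′)
        good e′ feeds with + t ∣? β (proj₁ e′)
        ... | yes t∣β = t∣β
        ... | no  t∤β = contradiction (e′ , t∤β , feeds) none

  module _ (t : ℕ) .{{_ : ℕ.NonZero t}} where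

    -- The coefficient of e_k in 1·a, with −1 represented by t − 1.
    abDigit : Fin m → OE → ℕ
    abDigit k (k′ , b) = if does (k′ ≟ k) then (if b then 1 else t ∸ 1) else 0

    abCoeffℕ : ∀ {l} → Vec OE l → Fin m → ℕ
    abCoeffℕ v k = sumℕ (toList v) (abDigit k)

    +t≡+[t∸1]+1 : + t ≡ + (t ∸ 1) ℤ.+ + 1
    +t≡+[t∸1]+1 = ≡.trans (≡.cong +_ (≡.sym (≡.trans (ℕ.+-comm (t ∸ 1) 1) (ℕ.suc-pred t)))) (ℤ.pos-+ (t ∸ 1) 1)

    abDigit-congruent : ∀ k a → + t ∣ (+ abDigit k a - edgeChain a k)
    abDigit-congruent k (k′ , b) with does (k′ ≟ k) | b
    ... | false | _     = ℤ∣.divides (+ 0) ≡.refl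
    ... | true  | true  = ℤ∣.divides (+ 0) ≡.refl
    ... | true  | false = ℤ∣.∣-reflexive +t≡+[t∸1]+1

    abCoeffℕ-congruent : ∀ {l} (v : Vec OE l) k → + t ∣ (+ abCoeffℕ v k - abCoeff v k)
    abCoeffℕ-congruent Vec.[] k = ℤ∣.divides (+ 0) ≡.refl
    abCoeffℕ-congruent (a ∷ v) k =
      ≡.subst (+ t ∣_) (≡.sym split) (ℤ∣.∣m∣n⇒∣m+n (abDigit-congruent k a) (abCoeffℕ-congruent v k))
      where
      rearrange : ∀ a b c d → (a ℤ.+ b) - (c ℤ.+ d) ≡ (a - c) ℤ.+ (b - d)
      rearrange = solve-∀
      split : + abCoeffℕ (a ∷ v) k - abCoeff (a ∷ v) k ≡ (+ abDigit k a - edgeChain a k) ℤ.+ (+ abCoeffℕ v k - abCoeff v k)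
      split = ≡.trans (≡.cong₂ _-_ (ℤ.pos-+ (abDigit k a) (abCoeffℕ v k)) (abCoeff-∷ a v k))
        (rearrange (+ abDigit k a) (+ abCoeffℕ v k) (edgeChain a k) (abCoeff v k))

    exponent : ∀ {l} → (Fin m → Fin t) → Vec OE l → Fin m → ℕ
    exponent α v k = (t ∸ 1) ℕ.* toℕ (α k) ℕ.+ abCoeffℕ v k

    exponent-congruent : ∀ {l} α (v : Vec OE l) k → + t ∣ (+ exponent α v k - (abCoeff v k - + toℕ (α k)))
    exponent-congruent α v k = ≡.subst (+ t ∣_) (≡.sym split)
      (ℤ∣.∣m∣n⇒∣m+n (ℤ∣.∣m⇒∣m*n (+ toℕ (α k)) (ℤ∣.∣-refl {+ t})) (abCoeffℕ-congruent v k))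
      where
      rearrange : ∀ s a d b → (s ℤ.* a ℤ.+ d) - (b - a) ≡ (s ℤ.+ + 1) ℤ.* a ℤ.+ (d - b)
      rearrange = solve-∀
      +exponent : + exponent α v k ≡ + (t ∸ 1) ℤ.* + toℕ (α k) ℤ.+ + abCoeffℕ v k
      +exponent = ≡.trans (ℤ.pos-+ ((t ∸ 1) ℕ.* toℕ (α k)) (abCoeffℕ v k))
        (≡.cong (ℤ._+ + abCoeffℕ v k) (ℤ.pos-* (t ∸ 1) (toℕ (α k))))
      split : + exponent α v k - (abCoeff v k - + toℕ (α k)) ≡ + t ℤ.* + toℕ (α k) ℤ.+ (+ abCoeffℕ v k - abCoeff v k)
      split = ≡.trans (≡.cong (_- (abCoeff v k - + toℕ (α k))) +exponent)
              (≡.trans (rearrange (+ (t ∸ 1)) (+ toℕ (α k)) (+ abCoeffℕ v k) (abCoeff v k))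
                (≡.cong (λ s → s ℤ.* + toℕ (α k) ℤ.+ (+ abCoeffℕ v k - abCoeff v k)) (≡.sym +t≡+[t∸1]+1)))

    t∣exponent⇔ : ∀ {l} α (v : Vec OE l) k → t ∣ℕ exponent α v k ⇔ + t ∣ (abCoeff v k - + toℕ (α k))
    t∣exponent⇔ α v k = mk⇔
      (λ t∣E → ≡.subst (+ t ∣_) (cancel E β)
        (ℤ∣.∣m∣n⇒∣m-n (ℤ∣.∣ᵤ⇒∣ {+ t} {E} t∣E) (exponent-congruent α v k)))
      (λ t∣β → ℤ∣.∣⇒∣ᵤ {+ t} {E}
        (≡.subst (+ t ∣_) (uncancel E β) (ℤ∣.∣m∣n⇒∣m+n (exponent-congruent α v k) t∣β)))
      where
      E β : ℤ
      E = + exponent α v k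
      β = abCoeff v k - + toℕ (α k)
      cancel : ∀ e b → e - (e - b) ≡ b
      cancel = solve-∀
      uncancel : ∀ e b → (e - b) ℤ.+ b ≡ e
      uncancel = solve-∀

module MatrixPowers {c ℓ} (R : CommutativeRing c ℓ) where
  open CommutativeRing R hiding (zero)
  open RingDefs R
  open RingSums R
  open import Algebra.Properties.CommutativeSemigroup *-commutativeSemigroup using (interchange)
  open import Relation.Binary.Reasoning.Setoid setoid

  pathWeight : Mat I → I → Vec I k → I → Carrier
  pathWeight A i []      j = A i j
  pathWeight A i (x ∷ w) j = A i x * pathWeight A x w j

  pathWeight-∷ʳ : ∀ (A : Mat I) i (w : Vec I k) x j → pathWeight A i (w ∷ʳ x) j ≈ pathWeight A i w x * A x j
  pathWeight-∷ʳ A i []      x j = refl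
  pathWeight-∷ʳ A i (z ∷ w) x j = trans (*-congˡ (pathWeight-∷ʳ A z w x j)) (sym (*-assoc _ _ _))

  powS-pathSum : ∀ xs (A : Mat I) k i j → powS xs A k i j ≈ sumL (vecs xs k) (λ w → pathWeight A i w j)
  powS-pathSum xs A zero    i j = sym (+-identityʳ _)
  powS-pathSum xs A (suc k) i j = begin
    sumL xs (λ x → powS xs A k i x * A x j)
      ≈⟨ Σ.foldMap-cong xs (λ x → *-congʳ (powS-pathSum xs A k i x)) ⟩
    sumL xs (λ x → sumL (vecs xs k) (λ w → pathWeight A i w x) * A x j)
      ≈⟨ Σ.foldMap-cong xs (λ x → sumL-*ʳ (A x j) (vecs xs k) _) ⟩
    sumL xs (λ x → sumL (vecs xs k) (λ w → pathWeight A i w x * A x j))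
      ≈⟨ Σ.foldMap-comm xs (vecs xs k) _ ⟩
    sumL (vecs xs k) (λ w → sumL xs (λ x → pathWeight A i w x * A x j))
      ≈⟨ Σ.foldMap-cong (vecs xs k) (λ w → Σ.foldMap-cong xs (λ x → pathWeight-∷ʳ A i w x j)) ⟨
    sumL (vecs xs k) (λ w → sumL xs (λ x → pathWeight A i (w ∷ʳ x) j))
      ≈⟨ Σ.foldMap-vecs-∷ʳ xs k _ ⟨
    sumL (vecs xs (suc k)) (λ w → pathWeight A i w j) ∎

  trace-powS : ∀ xs (A : Mat I) k →
    trace xs (powS xs A k) ≈ sumL (vecs xs (suc k)) (λ v → pathWeight A (Vec.head v) (Vec.tail v) (Vec.head v))
  trace-powS xs A k = trans (Σ.foldMap-cong xs (λ i → powS-pathSum xs A k i i)) (sym (Σ.foldMap-vecs-∷ xs k _))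

  module _ {R : Rel I r} (R? : Decidable R) (weight : I → Carrier) where

    weighted : Mat I
    weighted i j = if does (R? i j) then weight i else 0#

    pathWeight-weighted : ∀ x (w : Vec I k) y →
      pathWeight weighted x w y ≈ 𝟙 (does (Pointwise.decidable R? (x ∷ w) (w ∷ʳ y))) * Π.foldMap (toList (x ∷ w)) weight
    pathWeight-weighted x [] y with does (R? x y)
    ... | true  = sym (trans (*-identityˡ _) (*-identityʳ _))
    ... | false = sym (zeroˡ _)
    pathWeight-weighted x (z ∷ w) y = begin
      weighted x z * pathWeight weighted z w y
        ≈⟨ *-cong (if-else-0# (does (R? x z)) (weight x)) (pathWeight-weighted z w y) ⟩
      (𝟙 (does (R? x z)) * weight x) *
        (𝟙 (does (Pointwise.decidable R? (z ∷ w) (w ∷ʳ y))) * Π.foldMap (toList (z ∷ w)) weight)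
        ≈⟨ interchange _ _ _ _ ⟩
      (𝟙 (does (R? x z)) * 𝟙 (does (Pointwise.decidable R? (z ∷ w) (w ∷ʳ y)))) * Π.foldMap (toList (x ∷ z ∷ w)) weight
        ≈⟨ *-congʳ (𝟙-∧ _ _) ⟨
      𝟙 (does (Pointwise.decidable R? (x ∷ z ∷ w) ((z ∷ w) ∷ʳ y))) * Π.foldMap (toList (x ∷ z ∷ w)) weight ∎

    trace-weighted : ∀ xs k → trace xs (powS xs weighted k) ≈
      sumL (vecs xs (suc k)) (λ v → 𝟙 (does (Pointwise.decidable R? v (rotate v))) * Π.foldMap (toList v) weight)
    trace-weighted xs k =
      trans (trace-powS xs weighted k) (Σ.foldMap-cong (vecs xs (suc k)) λ { (x ∷ w) → pathWeight-weighted x w x })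

module TransferMatrices {c ℓ} (R : CommutativeRing c ℓ) (G : Graph) (t : ℕ) (ε : CommutativeRing.Carrier R) where
  open CommutativeRing R hiding (zero)
  open RingDefs R
  open RingSums R
  open MatrixPowers R
  open GraphDefs G
  open Walks G
  open import Algebra.Properties.CommutativeSemigroup *-commutativeSemigroup using (interchange)
  open import Relation.Binary.Reasoning.Setoid setoid hiding (start)

  χ* : (Fin m → Fin t) → Vec OE k → Carrier
  χ* γ v = Π.foldMap (toList v) (χ G t ε γ)

  trace-W1γ : ∀ γ l → trace allOE (powS allOE (W1γ G t ε γ) l) ≈
    sumL (vecs allOE (suc l)) (λ v → 𝟙 (does (circuit? v)) * χ* γ v)
  -- W1γ G t ε γ is definitionally weighted feedsInto? (χ G t ε γ).
  trace-W1γ γ l = trans (trace-weighted feedsInto? (χ G t ε γ) allOE l)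
    (Σ.foldMap-cong (vecs allOE (suc l)) λ v →
      *-congʳ (reflexive (≡.cong 𝟙
        (does-⇔ (⇔.sym (circuit⇔ v)) (Pointwise.decidable feedsInto? v (rotate v)) (circuit? v)))))

  walkIndicator : Fin n → Vec OE k → Fin n → Carrier
  walkIndicator x []      y = 𝟙 (does (x ≟ y))
  walkIndicator x (e ∷ u) y = 𝟙 (does (start e ≟ x)) * walkIndicator (end e) u y

  walkIndicator-linked : ∀ e (u : Vec OE k) f →
    walkIndicator (end e) u (start f) ≈ 𝟙 (does (Pointwise.decidable consecutive? (e ∷ u) (u ∷ʳ f)))
  walkIndicator-linked e []      f = reflexive (≡.cong 𝟙
    (≡.trans (does-⇔ (mk⇔ ≡.sym ≡.sym) (end e ≟ start f) (start f ≟ end e)) (≡.sym (Bool.∧-identityʳ _))))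
  walkIndicator-linked e (e′ ∷ u) f = trans (*-congˡ (walkIndicator-linked e′ u f)) (sym (𝟙-∧ _ _))

  Aγ-row : ∀ γ x (Ψ : Fin n → Carrier) →
    sumL (List.allFin n) (λ z → Aγ G t ε γ x z * Ψ z) ≈
    sumL allOE (λ e → (𝟙 (does (start e ≟ x)) * χ G t ε γ e) * Ψ (end e))
  Aγ-row γ x Ψ = begin
    sumL (List.allFin n) (λ z → Aγ G t ε γ x z * Ψ z)
      ≈⟨ Σ.foldMap-cong (List.allFin n) (λ z → sumL-*ʳ (Ψ z) allOE _) ⟩
    sumL (List.allFin n) (λ z → sumL allOE (λ e → entry e z * Ψ z))
      ≈⟨ Σ.foldMap-comm (List.allFin n) allOE _ ⟩
    sumL allOE (λ e → sumL (List.allFin n) (λ z → entry e z * Ψ z))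
      ≈⟨ Σ.foldMap-cong allOE (λ e → Σ.foldMap-allFin-single (end e) (off e)) ⟩
    sumL allOE (λ e → entry e (end e) * Ψ (end e))
      ≈⟨ Σ.foldMap-cong allOE (λ e → *-congʳ (on e (end e ≟ end e))) ⟩
    sumL allOE (λ e → (𝟙 (does (start e ≟ x)) * χ G t ε γ e) * Ψ (end e)) ∎
    where
    entry : OE → Fin n → Carrier
    entry e z = if does (start e ≟ x) ∧ does (end e ≟ z) then χ G t ε γ e else 0#
    off : ∀ e z → z ≢ end e → entry e z * Ψ z ≈ 0#
    off e z z≢end with does (start e ≟ x) | end e ≟ z
    ... | false | _          = zeroˡ _
    ... | true  | no _       = zeroˡ _
    ... | true  | yes end≡z  = contradiction (≡.sym end≡z) z≢end
    on : ∀ e (d : Dec (end e ≡ end e)) →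
      (if does (start e ≟ x) ∧ does d then χ G t ε γ e else 0#) ≈ 𝟙 (does (start e ≟ x)) * χ G t ε γ e
    on e (yes _) = trans (if-else-0# _ _) (*-congʳ (reflexive (≡.cong 𝟙 (Bool.∧-identityʳ _))))
    on e (no end≢end) = contradiction ≡.refl end≢end

  Aγ-pathSum : ∀ γ k x y → sumL (vecs (List.allFin n) k) (λ w → pathWeight (Aγ G t ε γ) x w y) ≈
    sumL (vecs allOE (suc k)) (λ u → walkIndicator x u y * χ* γ u)
  Aγ-pathSum γ zero x y = begin
    Aγ G t ε γ x y + 0#
      ≈⟨ +-identityʳ _ ⟩
    sumL allOE (λ e → if does (start e ≟ x) ∧ does (end e ≟ y) then χ G t ε γ e else 0#)
      ≈⟨ Σ.foldMap-cong allOE (λ e → trans (if-else-0# _ _) (*-cong (𝟙-∧ _ _) (sym (*-identityʳ _)))) ⟩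
    sumL allOE (λ e → walkIndicator x (e ∷ []) y * χ* γ (e ∷ []))
      ≈⟨ Σ.foldMap-cong allOE (λ e → +-identityʳ _) ⟨
    sumL allOE (λ e → walkIndicator x (e ∷ []) y * χ* γ (e ∷ []) + 0#)
      ≈⟨ Σ.foldMap-vecs-∷ allOE zero _ ⟨
    sumL (vecs allOE 1) (λ u → walkIndicator x u y * χ* γ u) ∎
  Aγ-pathSum γ (suc k) x y = begin
    sumL (vecs Vs (suc k)) (λ w → pathWeight Aᵧ x w y)
      ≈⟨ Σ.foldMap-vecs-∷ Vs k _ ⟩
    sumL Vs (λ z → sumL (vecs Vs k) (λ w → Aᵧ x z * pathWeight Aᵧ z w y))
      ≈⟨ Σ.foldMap-cong Vs (λ z → sumL-*ˡ (Aᵧ x z) (vecs Vs k) _) ⟨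
    sumL Vs (λ z → Aᵧ x z * sumL (vecs Vs k) (λ w → pathWeight Aᵧ z w y))
      ≈⟨ Σ.foldMap-cong Vs (λ z → *-congˡ (Aγ-pathSum γ k z y)) ⟩
    sumL Vs (λ z → Aᵧ x z * Ψ z)
      ≈⟨ Aγ-row γ x Ψ ⟩
    sumL allOE (λ e → (𝟙 (does (start e ≟ x)) * χ G t ε γ e) * Ψ (end e))
      ≈⟨ Σ.foldMap-cong allOE (λ e → sumL-*ˡ _ (vecs allOE (suc k)) _) ⟩
    sumL allOE (λ e → sumL (vecs allOE (suc k)) (λ u →
      (𝟙 (does (start e ≟ x)) * χ G t ε γ e) * (walkIndicator (end e) u y * χ* γ u)))
      ≈⟨ Σ.foldMap-cong allOE (λ e → Σ.foldMap-cong (vecs allOE (suc k)) (λ u → interchange _ _ _ _)) ⟩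
    sumL allOE (λ e → sumL (vecs allOE (suc k)) (λ u → walkIndicator x (e ∷ u) y * χ* γ (e ∷ u)))
      ≈⟨ Σ.foldMap-vecs-∷ allOE (suc k) _ ⟨
    sumL (vecs allOE (suc (suc k))) (λ u → walkIndicator x u y * χ* γ u) ∎
    where
    Vs : List (Fin n)
    Vs = List.allFin n
    Aᵧ : Mat (Fin n)
    Aᵧ = Aγ G t ε γ
    Ψ : Fin n → Carrier
    Ψ z = sumL (vecs allOE (suc k)) (λ u → walkIndicator z u y * χ* γ u)

  trace-Aγ : ∀ γ l → trace (List.allFin n) (powS (List.allFin n) (Aγ G t ε γ) l) ≈
    sumL (vecs allOE (suc l)) (λ v → 𝟙 (does (closedWalk? v)) * χ* γ v)
  trace-Aγ γ l = begin
    sumL Vs (λ x → powS Vs (Aγ G t ε γ) l x x)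
      ≈⟨ Σ.foldMap-cong Vs (λ x → trans (powS-pathSum Vs _ l x x) (Aγ-pathSum γ l x x)) ⟩
    sumL Vs (λ x → sumL Us (λ u → walkIndicator x u x * χ* γ u))
      ≈⟨ Σ.foldMap-comm Vs Us _ ⟩
    sumL Us (λ u → sumL Vs (λ x → walkIndicator x u x * χ* γ u))
      ≈⟨ Σ.foldMap-cong Us (λ u → trans (sym (sumL-*ʳ (χ* γ u) Vs _)) (*-congʳ (closing u))) ⟩
    sumL Us (λ v → 𝟙 (does (closedWalk? v)) * χ* γ v) ∎
    where
    Vs : List (Fin n)
    Vs = List.allFin n
    Us : List (Vec OE (suc l))
    Us = vecs allOE (suc l)
    closing : ∀ (v : Vec OE (suc l)) → sumL Vs (λ x → walkIndicator x v x) ≈ 𝟙 (does (closedWalk? v))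
    closing v@(e ∷ u) = begin
      sumL Vs (λ x → 𝟙 (does (start e ≟ x)) * walkIndicator (end e) u x)
        ≈⟨ Σ.foldMap-allFin-single (start e) off ⟩
      𝟙 (does (start e ≟ start e)) * walkIndicator (end e) u (start e)
        ≡⟨ ≡.cong (λ b → 𝟙 b * walkIndicator (end e) u (start e)) (dec-true (start e ≟ start e) ≡.refl) ⟩
      1# * walkIndicator (end e) u (start e)
        ≈⟨ *-identityˡ _ ⟩
      walkIndicator (end e) u (start e)
        ≈⟨ walkIndicator-linked e u e ⟩
      𝟙 (does (Pointwise.decidable consecutive? v (rotate v)))
        ≡⟨ ≡.cong 𝟙 (does-⇔ (⇔.sym (closedWalk⇔ v)) (Pointwise.decidable consecutive? v (rotate v)) (closedWalk? v)) ⟩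
      𝟙 (does (closedWalk? v)) ∎
      where
      off : ∀ x → x ≢ start e → 𝟙 (does (start e ≟ x)) * walkIndicator (end e) u x ≈ 0#
      off x x≢start with start e ≟ x
      ... | yes start≡x = contradiction (≡.sym start≡x) x≢start
      ... | no  _       = zeroˡ _

module Weights {c ℓ} (R : CommutativeRing c ℓ) (G : Graph) (t : ℕ) .{{_ : ℕ.NonZero t}} (ε : CommutativeRing.Carrier R) where
  open CommutativeRing R hiding (zero)
  open RingDefs R
  open RingSums R
  open GraphDefs G
  open Chains G
  open TransferMatrices R G t ε
  open import Relation.Binary.Reasoning.Setoid setoid hiding (start)

  Fins : List (Fin m)
  Fins = List.allFin m

  χ-as-product : ∀ γ a → χ G t ε γ a ≈ Π.foldMap Fins (λ k → pow ε (toℕ (γ k) ℕ.* abDigit t k a))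
  χ-as-product γ (k′ , b) = sym (trans (Π.foldMap-allFin-single k′ off) (on b (k′ ≟ k′)))
    where
    off : ∀ k → k ≢ k′ → pow ε (toℕ (γ k) ℕ.* abDigit t k (k′ , b)) ≈ 1#
    off k k≢k′ with k′ ≟ k
    ... | yes k′≡k = contradiction (≡.sym k′≡k) k≢k′
    ... | no  _    = reflexive (≡.cong (pow ε) (ℕ.*-zeroʳ (toℕ (γ k))))
    on : ∀ b (d : Dec (k′ ≡ k′)) →
      pow ε (toℕ (γ k′) ℕ.* (if does d then (if b then 1 else t ∸ 1) else 0)) ≈ χ G t ε γ (k′ , b)
    on true  (yes _)     = reflexive (≡.cong (pow ε) (ℕ.*-identityʳ (toℕ (γ k′))))
    on false (yes _)     = reflexive (≡.cong (pow ε) (ℕ.*-comm (toℕ (γ k′)) (t ∸ 1)))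
    on _     (no k′≢k′)  = contradiction ≡.refl k′≢k′

  χ*-as-product : ∀ {l} γ (v : Vec OE l) → χ* γ v ≈ Π.foldMap Fins (λ k → pow ε (toℕ (γ k) ℕ.* abCoeffℕ t v k))
  χ*-as-product γ v = begin
    Π.foldMap (toList v) (χ G t ε γ)
      ≈⟨ Π.foldMap-cong (toList v) (χ-as-product γ) ⟩
    Π.foldMap (toList v) (λ a → Π.foldMap Fins (λ k → pow ε (toℕ (γ k) ℕ.* abDigit t k a)))
      ≈⟨ Π.foldMap-comm (toList v) Fins _ ⟩
    Π.foldMap Fins (λ k → Π.foldMap (toList v) (λ a → pow ε (toℕ (γ k) ℕ.* abDigit t k a)))
      ≈⟨ Π.foldMap-cong Fins (λ k → pow-sumℕ ε (toList v) _) ⟨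
    Π.foldMap Fins (λ k → pow ε (sumℕ (toList v) (λ a → toℕ (γ k) ℕ.* abDigit t k a)))
      ≈⟨ Π.foldMap-cong Fins (λ k → reflexive (≡.cong (pow ε) (sumℕ-*ˡ (toℕ (γ k)) (toList v) (abDigit t k)))) ⟨
    Π.foldMap Fins (λ k → pow ε (toℕ (γ k) ℕ.* abCoeffℕ t v k)) ∎

  εinv^-pairing : ∀ (γ α : Fin m → Fin t) →
    εinv^ G t ε (pairing γ α) ≈ Π.foldMap Fins (λ k → pow ε ((t ∸ 1) ℕ.* (toℕ (γ k) ℕ.* toℕ (α k))))
  εinv^-pairing γ α = trans (reflexive (≡.cong (pow ε) (sumℕ-*ˡ (t ∸ 1) Fins _))) (pow-sumℕ ε Fins _)

  weight-as-product : ∀ {l} (γ α : Fin m → Fin t) (v : Vec OE l) →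
    εinv^ G t ε (pairing γ α) * χ* γ v ≈ ∏ (λ k → pow ε (toℕ (γ k) ℕ.* exponent t α v k))
  weight-as-product γ α v = begin
    εinv^ G t ε (pairing γ α) * χ* γ v
      ≈⟨ *-cong (εinv^-pairing γ α) (χ*-as-product γ v) ⟩
    Π.foldMap Fins (pow ε ∘ fromα) * Π.foldMap Fins (pow ε ∘ fromv)
      ≈⟨ Π.foldMap-∙ Fins (pow ε ∘ fromα) (pow ε ∘ fromv) ⟨
    Π.foldMap Fins (λ k → pow ε (fromα k) * pow ε (fromv k))
      ≈⟨ Π.foldMap-cong Fins (λ k → sym (pow-+ ε (fromα k) (fromv k))) ⟩
    Π.foldMap Fins (λ k → pow ε (fromα k ℕ.+ fromv k))
      ≈⟨ Π.foldMap-cong Fins (λ k → reflexive (≡.cong (pow ε) (distribute (t ∸ 1) (toℕ (γ k)) (toℕ (α k)) _))) ⟩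
    Π.foldMap Fins (λ k → pow ε (toℕ (γ k) ℕ.* exponent t α v k))
      ≡⟨ Π.foldMap-tabulate m id _ ⟩
    ∏ (λ k → pow ε (toℕ (γ k) ℕ.* exponent t α v k)) ∎
    where
    fromα fromv : Fin m → ℕ
    fromα k = (t ∸ 1) ℕ.* (toℕ (γ k) ℕ.* toℕ (α k))
    fromv k = toℕ (γ k) ℕ.* abCoeffℕ t v k
    distribute : ∀ s g a d → s ℕ.* (g ℕ.* a) ℕ.+ g ℕ.* d ≡ g ℕ.* (s ℕ.* a ℕ.+ d)
    distribute = ℕ-Solver.solve-∀

module ChainSums {c ℓ} (R : CommutativeRing c ℓ) (G : Graph) (t : ℕ) .{{_ : ℕ.NonZero t}} (ε : CommutativeRing.Carrier R)
  (T : Fin (Graph.m G) → Bool) where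
  open CommutativeRing R hiding (zero)
  open RingDefs R
  open RingSums R
  open GraphDefs G
  open import Relation.Binary.Reasoning.Setoid setoid hiding (start)

  vanishesOn? : ∀ b (j : Fin t) → Dec (b ≡ true → toℕ j ≡ 0)
  vanishesOn? b j = (b Bool.≟ true) →-dec (toℕ j ℕ.≟ 0)

  𝟙-inM : ∀ γ → 𝟙 (does (inM? T γ)) ≈ ∏ (λ k → 𝟙 (does (vanishesOn? (T k) (γ k))))
  𝟙-inM γ = trans (reflexive (≡.cong 𝟙 (does-⇔ (mk⇔ id id) (inM? T γ) (all? vanishes?))))
    (𝟙-all? vanishes?)
    where
    vanishes? : ∀ k → Dec (T k ≡ true → toℕ (γ k) ≡ 0)
    vanishes? k = vanishesOn? (T k) (γ k)

  vanishing-factor : ∀ b e → sumL (List.allFin t) (λ j → 𝟙 (does (vanishesOn? b j)) * pow ε (toℕ j ℕ.* e)) ≈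
    (if b then 1# else sumL (List.allFin t) (λ j → pow ε (toℕ j ℕ.* e)))
  vanishing-factor false e = Σ.foldMap-cong (List.allFin t) (λ j → *-identityˡ _)
  vanishing-factor true  e = trans (Σ.foldMap-allFin-single j₀ off) at-j₀
    where
    j₀ : Fin t
    j₀ = fromℕ< (ℕ.>-nonZero⁻¹ t)
    off : ∀ j → j ≢ j₀ → 𝟙 (does (vanishesOn? true j)) * pow ε (toℕ j ℕ.* e) ≈ 0#
    off j j≢j₀ = trans (*-congʳ (reflexive (≡.cong 𝟙 (dec-false (toℕ j ℕ.≟ 0) j≢0)))) (zeroˡ _)
      where
      j≢0 : toℕ j ≢ 0
      j≢0 j≡0 = j≢j₀ (Fin.toℕ-injective (≡.trans j≡0 (≡.sym (toℕ-fromℕ< _))))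
    at-j₀ : 𝟙 (does (vanishesOn? true j₀)) * pow ε (toℕ j₀ ℕ.* e) ≈ 1#
    at-j₀ rewrite toℕ-fromℕ< (ℕ.>-nonZero⁻¹ t) = *-identityˡ 1#

  sum-over-M : ∀ (E : Fin m → ℕ) → sumL (M t T) (λ γ → ∏ (λ k → pow ε (toℕ (γ k) ℕ.* E k))) ≈
    ∏ (λ k → if T k then 1# else sumL (List.allFin t) (λ j → pow ε (toℕ j ℕ.* E k)))
  sum-over-M E = begin
    sumL (M t T) F
      ≈⟨ sumL-filter (inM? T) (allChains t m) F ⟩
    sumL (allChains t m) (λ γ → 𝟙 (does (inM? T γ)) * F γ)
      ≡⟨ Σ.foldMap-map Vec.lookup (vecs (List.allFin t) m) _ ⟩
    sumL (vecs (List.allFin t) m) (λ w → 𝟙 (does (inM? T (Vec.lookup w))) * F (Vec.lookup w))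
      ≈⟨ Σ.foldMap-cong (vecs (List.allFin t) m) (λ w → trans (*-congʳ (𝟙-inM (Vec.lookup w)))
           (sym (∏-distrib-* (λ k → 𝟙ᵥ k (Vec.lookup w k)) (λ k → power k (Vec.lookup w k))))) ⟩
    sumL (vecs (List.allFin t) m) (λ w → ∏ (λ k → f k (Vec.lookup w k)))
      ≈⟨ sumL-vecs-∏ (List.allFin t) m f ⟩
    ∏ (λ k → sumL (List.allFin t) (f k))
      ≈⟨ ∏-cong (λ k → vanishing-factor (T k) (E k)) ⟩
    ∏ (λ k → if T k then 1# else sumL (List.allFin t) (λ j → pow ε (toℕ j ℕ.* E k))) ∎
    where
    𝟙ᵥ power f : Fin m → Fin t → Carrier
    𝟙ᵥ k j = 𝟙 (does (vanishesOn? (T k) j))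
    power k j = pow ε (toℕ j ℕ.* E k)
    f k j = 𝟙ᵥ k j * power k j
    F : (Fin m → Fin t) → Carrier
    F γ = ∏ (λ k → power k (γ k))

module CharacterSum {c ℓ} (R : CommutativeRing c ℓ) (domain : IsIntegralDomain R)
  (t : ℕ) .{{_ : ℕ.NonZero t}} (ε : CommutativeRing.Carrier R) (εPrimitive : RingDefs.IsPrimitiveRoot R t ε)
  (G : Graph) {T : Fin (Graph.m G) → Bool} (connected : GraphDefs.ConnectedVia G T) (forest : Walks.NoInfiniteWalk G T)
  (α : Fin (Graph.m G) → Fin t) (α-cycle : GraphDefs.IsCycle G t α) where
  open CommutativeRing R hiding (zero; _-_; -_)
  open RingDefs R
  open RingSums R
  open RootsOfUnity R domain t ε εPrimitive
  open GraphDefs G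
  open Walks G
  open Chains G
  open TransferMatrices R G t ε
  open Weights R G t ε
  open ChainSums R G t ε T
  open import Algebra.Properties.CommutativeSemigroup *-commutativeSemigroup using (x∙yz≈y∙xz)
  open import Relation.Binary.Reasoning.Setoid setoid hiding (start)

  residue : ∀ {l} → Vec OE l → Fin m → ℤ
  residue v k = abCoeff v k - + toℕ (α k)

  residue-balanced : ∀ (v : Vec OE (suc l)) → IsClosedWalk v → ∀ x → + t ∣ ∂ (residue v) x
  residue-balanced v closed x =
    ≡.subst (+ t ∣_) (≡.sym (≡.trans (∂-− (abCoeff v) α′ x) (≡.cong (_- ∂ α′ x) (closedWalk⇒∂≡0 v closed x))))
      (ℤ∣.∣m∣n⇒∣m-n (ℤ∣.divides (+ 0) ≡.refl) (ℤ∣.∣ᵤ⇒∣ {+ t} {∂ α′ x} (α-cycle x)))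
    where
    α′ : Fin m → ℤ
    α′ k = + toℕ (α k)

  offTree⇔abModEq : ∀ (v : Vec OE (suc l)) → IsClosedWalk v →
    (∀ k → T k ≡ false → t ∣ℕ exponent t α v k) ⇔ AbModEq t v α
  offTree⇔abModEq v closed = mk⇔
    (λ offTree k → ℤ∣.∣⇒∣ᵤ (cycle-vanishes t forest (residue v) (residue-balanced v closed)
                     (λ k k∉T → Equivalence.to (t∣exponent⇔ t α v k) (offTree k k∉T)) k))
    (λ congruent k _ → Equivalence.from (t∣exponent⇔ t α v k) (ℤ∣.∣ᵤ⇒∣ (congruent k)))

  characterSum : ∀ (v : Vec OE (suc l)) → IsClosedWalk v →
    sumL (M t T) (λ γ → εinv^ G t ε (pairing γ α) * χ* γ v) ≈ 𝟙 (does (abModEq? t v α)) * ofℕ (t ℕ.^ genus)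
  characterSum v closed = begin
    sumL (M t T) (λ γ → εinv^ G t ε (pairing γ α) * χ* γ v)
      ≈⟨ Σ.foldMap-cong (M t T) (λ γ → weight-as-product γ α v) ⟩
    sumL (M t T) (λ γ → ∏ (λ k → pow ε (toℕ (γ k) ℕ.* E k)))
      ≈⟨ sum-over-M E ⟩
    ∏ (λ k → if T k then 1# else sumL (List.allFin t) (λ j → pow ε (toℕ j ℕ.* E k)))
      ≈⟨ ∏-cong (λ k → if-congʳ (T k) (orthogonality (E k))) ⟩
    ∏ (λ k → if T k then 1# else 𝟙 (does (t ∣ℕ? E k)) * ofℕ t)
      ≈⟨ ∏-offSupport T (λ k → t ∣ℕ? E k) (ofℕ t) ⟩
    𝟙 (does (all? (offS? T (λ k → t ∣ℕ? E k)))) * pow (ofℕ t) ∣ not ∘ T ∣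
      ≡⟨ ≡.cong₂ (λ b g → 𝟙 b * pow (ofℕ t) g)
           (does-⇔ (offTree⇔abModEq v closed) (all? (offS? T (λ k → t ∣ℕ? E k))) (abModEq? t v α))
           (∣∁T∣≡genus G T (start (Vec.head v)) connected forest) ⟩
    𝟙 (does (abModEq? t v α)) * pow (ofℕ t) genus
      ≈⟨ *-congˡ (ofℕ-^ t genus) ⟨
    𝟙 (does (abModEq? t v α)) * ofℕ (t ℕ.^ genus) ∎
    where
    E : Fin m → ℕ
    E = exponent t α v
    if-congʳ : ∀ b {x y z} → y ≈ z → (if b then x else y) ≈ (if b then x else z)
    if-congʳ true  _   = refl
    if-congʳ false y≈z = y≈z

  countFormula : ∀ l {Q : Vec OE (suc l) → Set} (Q? : ∀ v → Dec (Q v)) → (∀ v → Q v → IsClosedWalk v) →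
    (tr : (Fin m → Fin t) → Carrier) → (∀ γ → tr γ ≈ sumL (vecs allOE (suc l)) (λ v → 𝟙 (does (Q? v)) * χ* γ v)) →
    ofℕ (t ℕ.^ genus) * ofℕ (List.length (List.filter (λ w → Q? w ×-dec abModEq? t w α) (vecs allOE (suc l))))
      ≈ sumL (M t T) (λ γ → εinv^ G t ε (pairing γ α) * tr γ)
  countFormula l {Q} Q? Q⇒closed tr tr≈ = sym (begin
    sumL (M t T) (λ γ → coeff γ * tr γ)
      ≈⟨ Σ.foldMap-cong (M t T) (λ γ → *-congˡ (tr≈ γ)) ⟩
    sumL (M t T) (λ γ → coeff γ * sumL Ws (λ v → 𝟙Q v * χ* γ v))
      ≈⟨ Σ.foldMap-cong (M t T) (λ γ → sumL-*ˡ (coeff γ) Ws _) ⟩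
    sumL (M t T) (λ γ → sumL Ws (λ v → coeff γ * (𝟙Q v * χ* γ v)))
      ≈⟨ Σ.foldMap-comm (M t T) Ws _ ⟩
    sumL Ws (λ v → sumL (M t T) (λ γ → coeff γ * (𝟙Q v * χ* γ v)))
      ≈⟨ Σ.foldMap-cong Ws (λ v → trans (Σ.foldMap-cong (M t T) (λ γ → x∙yz≈y∙xz _ _ _))
                                         (sym (sumL-*ˡ (𝟙Q v) (M t T) _))) ⟩
    sumL Ws (λ v → 𝟙Q v * sumL (M t T) (λ γ → coeff γ * χ* γ v))
      ≈⟨ Σ.foldMap-cong Ws (λ v → onlyQ v (Q? v)) ⟩
    sumL Ws (λ v → 𝟙Q v * (𝟙 (does (abModEq? t v α)) * ofℕ (t ℕ.^ genus)))
      ≈⟨ Σ.foldMap-cong Ws (λ v → trans (sym (*-assoc _ _ _)) (*-congʳ (sym (𝟙-∧ _ _)))) ⟩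
    sumL Ws (λ v → 𝟙 (does (Q? v ×-dec abModEq? t v α)) * ofℕ (t ℕ.^ genus))
      ≈⟨ sumL-*ʳ _ Ws _ ⟨
    sumL Ws (λ v → 𝟙 (does (Q? v ×-dec abModEq? t v α))) * ofℕ (t ℕ.^ genus)
      ≈⟨ *-congʳ (ofℕ-length-filter _ Ws) ⟨
    ofℕ (List.length (List.filter (λ w → Q? w ×-dec abModEq? t w α) Ws)) * ofℕ (t ℕ.^ genus)
      ≈⟨ *-comm _ _ ⟩
    ofℕ (t ℕ.^ genus) * ofℕ (List.length (List.filter (λ w → Q? w ×-dec abModEq? t w α) Ws)) ∎)
    where
    Ws : List (Vec OE (suc l))
    Ws = vecs allOE (suc l)
    coeff : (Fin m → Fin t) → Carrier
    coeff γ = εinv^ G t ε (pairing γ α)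
    𝟙Q : Vec OE (suc l) → Carrier
    𝟙Q v = 𝟙 (does (Q? v))
    onlyQ : ∀ v (d : Dec (Q v)) →
      𝟙 (does d) * sumL (M t T) (λ γ → coeff γ * χ* γ v) ≈ 𝟙 (does d) * (𝟙 (does (abModEq? t v α)) * ofℕ (t ℕ.^ genus))
    onlyQ v (yes q) = *-congˡ (characterSum v (Q⇒closed v q))
    onlyQ v (no _)  = trans (zeroˡ _) (sym (zeroˡ _))

theorem3p4 : ∀ {c ℓ} (R : CommutativeRing c ℓ) → IsIntegralDomain R →
  (ε : CommutativeRing.Carrier R) →
  (G : Graph) → GraphDefs.Connected G →
  (T : Fin (Graph.m G) → Bool) → GraphDefs.IsSpanningTree G T →
  (t : ℕ) → 2 ≤ t → RingDefs.IsPrimitiveRoot R t ε →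
  (α : Fin (Graph.m G) → Fin t) → GraphDefs.IsCycle G t α →
  (l' : ℕ) →
  let open CommutativeRing R
      open RingDefs R
      open GraphDefs G
  in (ofℕ (t ^ genus) * ofℕ (N t α l')
        ≈ sumL (M t T) (λ γ → εinv^ G t ε (pairing γ α) * trace allOE (powS allOE (W1γ G t ε γ) l')))
   × (ofℕ (t ^ genus) * ofℕ (Ñ t α l')
        ≈ sumL (M t T) (λ γ → εinv^ G t ε (pairing γ α) * trace (Data.List.allFin n) (powS (Data.List.allFin n) (Aγ G t ε γ) l')))
theorem3p4 R domain ε G _ T (connected , acyclic) t 2≤t εPrimitive α α-cycle l′ =
  countFormula l′ circuit? (λ _ → proj₁) _ (λ γ → trace-W1γ γ l′) ,
  countFormula l′ closedWalk? (λ _ closed → closed) _ (λ γ → trace-Aγ γ l′)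
  where
  instance
    t≢0 : NonZero t
    t≢0 = >-nonZero (ℕ.≤-trans (s≤s z≤n) 2≤t)
  open GraphDefs G
  open TransferMatrices R G t ε
  open CharacterSum R domain t ε εPrimitive G connected (Walks.acyclic⇒noInfiniteWalk G {T} acyclic) α α-cycle
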